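{- Let $G_0$ and $G_1$ be nonempty simple matroids on disjoint ground sets, choose points $p_0$ of $G_0$ and $p_1$ of $G_1$, and let $P(G_0,G_1)$ be the parallel connection of $G_0$ and $G_1$ along $p_0$ and $p_1$. Let $G=G_0\oplus G_1$ and $G'=\{0\}\oplus P(G_0,G_1)$, where $\{0\}$ is the rank-one matroid consisting of a single isthmus $0$. Then $\mathcal{A}(G)\cong\mathcal{A}(G')$ as graded algebras.
   Context: For a simple matroid $H$ on a finite ground set $E$, let $\mathcal{E}=\Lambda(e_i : i\in E)$ be the graded exterior algebra over $\mathbb{C}$ with generators $e_i$ of degree one. For an ordered tuple $S=(i_1,\ldots,i_p)$ write $e_S=e_{i_1}\wedge\cdots\wedge e_{i_p}$ and define $\partial:\mathcal{E}^p\to\mathcal{E}^{p-1}$ by $\partial(e_{i_1}\wedge\cdots\wedge e_{i_p})=\sum_{k=1}^p(-1)^{k-1}e_{i_1}\wedge\cdots\wedge\widehat{e_{i_k}}\wedge\cdots\wedge e_{i_p}$. Let $\mathcal{I}$ be the ideal generated by $\{\partial e_S : S\text{ dependent in }H\}$; the Orlik-Solomon algebra of $H$ is the graded algebra $\mathcal{A}(H)=\mathcal{E}/\mathcal{I}$. The parallel connection $P(G_0,G_1)$ along $p_0,p_1$ is the matroid whose ground set is the union of the ground sets of $G_0$ and $G_1$ with $p_0$ and $p_1$ identified to a single point $p$, and whose circuits are the circuits of $G_0$, the circuits of $G_1$, and the sets $(C_0\setminus\{p\})\cup(C_1\setminus\{p\})$ with $C_i$ a circuit of $G_i$ containing $p$.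 The symbol $\oplus$ denotes direct sum of matroids. -}

module Defs where

open import Level using (Level; _⊔_) renaming (suc to lsuc; zero to lzero)
open import Data.Nat using (ℕ; zero; suc; _+_; _≤_; _<_)
open import Data.Bool using (Bool; true; false; if_then_else_) renaming (_≟_ to _≟ᵇ_)
open import Data.Fin using (Fin; _↑ˡ_; _↑ʳ_; punchOut) renaming (_≟_ to _≟ᶠ_)
open import Data.Fin.Subset using (Subset; _∈_; _∉_; _⊆_; _⊂_; _∪_; ⁅_⁆; ∣_∣; ⊥)
open import Data.Vec using (Vec; []; _∷_; take; drop)
open import Data.Vec.Properties using (≡-dec)
open import Data.Product using (Σ; ∃; _×_; _,_)
open import Data.Sum using (_⊎_)
open import Data.Empty renaming (⊥ to Empty)
open import Relation.Nullary using (¬_; Dec; yes; no; does)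
open import Relation.Binary.PropositionalEquality using (_≡_; _≢_)
open import Algebra.Bundles using (CommutativeRing)

record Field (c ℓ : Level) : Set (lsuc (c ⊔ ℓ)) where
  field
    commutativeRing : CommutativeRing c ℓ
  open CommutativeRing commutativeRing public
  field
    1≉0     : ¬ (1# ≈ 0#)
    inverse : ∀ x → ¬ (x ≈ 0#) → Σ Carrier (λ y → (x * y) ≈ 1#)

_⇔_ : Set → Set → Set
A ⇔ B = (A → B) × (B → A)

record Matroid (n : ℕ) : Set₁ where
  field
    Indep      : Subset n → Set
    indep?     : ∀ S → Dec (Indep S)
    indep-⊥    : Indep ⊥
    hereditary : ∀ {A B} → A ⊆ B → Indep B → Indep A
    exchange   : ∀ {A B} → Indep A → Indep B → ∣ A ∣ < ∣ B ∣ →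
                 ∃ λ x → x ∈ B × x ∉ A × Indep (A ∪ ⁅ x ⁆)

open Matroid public

Dependent : ∀ {n} → Matroid n → Subset n → Set
Dependent M S = ¬ Indep M S

Circuit : ∀ {n} → Matroid n → Subset n → Set
Circuit M C = Dependent M C × (∀ D → D ⊂ C → Indep M D)

-- simple: no loops and no parallel pairs, i.e. all sets of size ≤ 2 independent
Simple : ∀ {n} → Matroid n → Set
Simple M = ∀ S → ∣ S ∣ ≤ 2 → Indep M S

-- Matroids described by their dependent sets (all the Orlik-Solomon
-- algebra needs).  Direct sums on Fin (m + k) (first m points = first
-- summand) and the single isthmus {0}.

DepSum : ∀ {m k} → (Subset m → Set) → (Subset k → Set) → Subset (m + k) → Set
DepSum {m} D₀ D₁ S = D₀ (take m S) ⊎ D₁ (drop m S)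

DepIsthmus : Subset 1 → Set
DepIsthmus _ = Empty

DepDirectSum : ∀ {m k} → Matroid m → Matroid k → Subset (m + k) → Set
DepDirectSum G₀ G₁ = DepSum (Dependent G₀) (Dependent G₁)

-- Parallel connection P(G₀,G₁) along p₀, p₁.  Ground set Fin (suc a + b):
-- the points of G₀ (via ι₀) followed by the points of G₁ other than p₁;
-- p₁ is identified with ι₀ p₀ (the point p).

module Parallel {a b : ℕ} (G₀ : Matroid (suc a)) (G₁ : Matroid (suc b))
                (p₀ : Fin (suc a)) (p₁ : Fin (suc b)) where

  ι₀ : Fin (suc a) → Fin (suc a + b)
  ι₀ x = x ↑ˡ b

  ι₁ : Fin (suc b) → Fin (suc a + b)
  ι₁ j with p₁ ≟ᶠ j
  ... | yes _ = ι₀ p₀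
  ... | no ne = suc a ↑ʳ punchOut ne

  IsImage : ∀ {n} → (Fin n → Fin (suc a + b)) → Subset n → Subset (suc a + b) → Set
  IsImage f C T = ∀ y → (y ∈ T) ⇔ (∃ λ x → x ∈ C × f x ≡ y)

  PCircuit : Subset (suc a + b) → Set
  PCircuit T =
      (∃ λ C₀ → Circuit G₀ C₀ × IsImage ι₀ C₀ T)
    ⊎ (∃ λ C₁ → Circuit G₁ C₁ × IsImage ι₁ C₁ T)
    ⊎ (∃ λ C₀ → ∃ λ C₁ → Circuit G₀ C₀ × p₀ ∈ C₀ × Circuit G₁ C₁ × p₁ ∈ C₁ ×
         (∀ y → (y ∈ T) ⇔ ((∃ λ x → x ∈ C₀ × x ≢ p₀ × ι₀ x ≡ y)
                          ⊎ (∃ λ x → x ∈ C₁ × x ≢ p₁ × ι₁ x ≡ y))))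

  -- dependent in the matroid with these circuits = contains a circuit
  DepP : Subset (suc a + b) → Set
  DepP S = ∃ λ T → PCircuit T × T ⊆ S

DepParallel : ∀ {a b} → Matroid (suc a) → Matroid (suc b) → Fin (suc a) → Fin (suc b) →
              Subset (suc a + b) → Set
DepParallel G₀ G₁ p₀ p₁ = Parallel.DepP G₀ G₁ p₀ p₁

-- Exterior algebra over a field K on generators e₀,…,e_{n-1}, and the
-- Orlik-Solomon algebra as a quotient (represented by the ideal).
-- An element is its coefficient function on the basis e_S, S ⊆ Fin n,
-- where e_S = e_{i₁} ∧ ⋯ ∧ e_{i_p} with i₁ < ⋯ < i_p.

module OS {c ℓ : Level} (K : Field c ℓ) where
  open Field K using (Carrier; _≈_; 0#; 1#) renaming (_+_ to _+ᴷ_; _*_ to _*ᴷ_; -_ to -ᴷ_; _-_ to _-ᴷ_)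

  E : ℕ → Set c
  E n = Subset n → Carrier

  _≋_ : ∀ {n} → E n → E n → Set ℓ
  x ≋ y = ∀ S → x S ≈ y S

  𝟘 : ∀ {n} → E n
  𝟘 _ = 0#

  _⊕_ _⊖_ : ∀ {n} → E n → E n → E n
  (x ⊕ y) S = x S +ᴷ y S
  (x ⊖ y) S = x S -ᴷ y S

  _⊙_ : ∀ {n} → Carrier → E n → E n
  (r ⊙ x) S = r *ᴷ x S

  basis : ∀ {n} → Subset n → E n
  basis T S = if does (≡-dec _≟ᵇ_ S T) then 1# else 0#

  𝟙 : ∀ {n} → E n
  𝟙 = basis ⊥

  gen : ∀ {n} → Fin n → E n
  gen i = basis ⁅ i ⁆

  signPow : ℕ → Carrier → Carrier
  signPow zero    r = r
  signPow (suc k) r = -ᴷ signPow k r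

  σ : ∀ {n} → E n → E n
  σ x S = signPow ∣ S ∣ (x S)

  -- x = e₀ ∧ xT + xF, with xT, xF not involving e₀
  tl : ∀ {n} → E (suc n) → E n
  tl x S = x (true ∷ S)
  fl : ∀ {n} → E (suc n) → E n
  fl x S = x (false ∷ S)

  -- exterior product:  (e₀ xT + xF)(e₀ yT + yF) = e₀ (xT yF + σ(xF) yT) + xF yF
  infixl 7 _∧_
  _∧_ : ∀ {n} → E n → E n → E n
  _∧_ {zero}  x y []          = x [] *ᴷ y []
  _∧_ {suc n} x y (true ∷ U)  = (tl x ∧ fl y) U +ᴷ (σ (fl x) ∧ tl y) U
  _∧_ {suc n} x y (false ∷ U) = (fl x ∧ fl y) U

  -- ∂ (linear, degree -1): ∂(e₀ w + v) = w - e₀ ∂w + ∂v, which agrees with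
  -- ∂(e_{i₁}∧⋯∧e_{i_p}) = Σ_k (-1)^{k-1} e_{i₁}∧⋯ê_{i_k}⋯∧e_{i_p}
  ∂ : ∀ {n} → E n → E n
  ∂ {zero}  x []          = 0#
  ∂ {suc n} x (true ∷ U)  = -ᴷ ∂ (tl x) U
  ∂ {suc n} x (false ∷ U) = tl x U +ᴷ ∂ (fl x) U

  data InIdeal {n} (Dep : Subset n → Set) : E n → Set (c ⊔ ℓ) where
    gen0 : InIdeal Dep 𝟘
    genS : ∀ x y S → Dep S → InIdeal Dep (x ∧ ∂ (basis S) ∧ y)
    add  : ∀ {x y} → InIdeal Dep x → InIdeal Dep y → InIdeal Dep (x ⊕ y)
    resp : ∀ {x y} → x ≋ y → InIdeal Dep x → InIdeal Dep y

  -- congruence modulo the ideal = equality in 𝒜 = ℰ / ℐ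
  Cong : ∀ {n} → (Subset n → Set) → E n → E n → Set (c ⊔ ℓ)
  Cong Dep x y = InIdeal Dep (x ⊖ y)

  Homogeneous : ∀ {n} → ℕ → E n → Set ℓ
  Homogeneous p x = ∀ S → ¬ (∣ S ∣ ≡ p) → x S ≈ 0#

  -- an isomorphism of graded K-algebras ℰ/ℐ_D ≅ ℰ'/ℐ_D', given on representatives
  record GradedAlgIso {n n'} (D : Subset n → Set) (D' : Subset n' → Set) : Set (c ⊔ ℓ) where
    field
      f : E n → E n'
      g : E n' → E n
      f-resp : ∀ {x y} → Cong D x y → Cong D' (f x) (f y)
      f-+    : ∀ x y → Cong D' (f (x ⊕ y)) (f x ⊕ f y)
      f-⊙    : ∀ r x → Cong D' (f (r ⊙ x)) (r ⊙ f x)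
      f-∧    : ∀ x y → Cong D' (f (x ∧ y)) (f x ∧ f y)
      f-𝟙    : Cong D' (f 𝟙) 𝟙
      f-deg  : ∀ p x → Homogeneous p x → Σ (E n') λ y → Homogeneous p y × Cong D' (f x) y
      g-resp : ∀ {x y} → Cong D' x y → Cong D (g x) (g y)
      g-+    : ∀ x y → Cong D (g (x ⊕ y)) (g x ⊕ g y)
      g-⊙    : ∀ r x → Cong D (g (r ⊙ x)) (r ⊙ g x)
      g-∧    : ∀ x y → Cong D (g (x ∧ y)) (g x ∧ g y)
      g-𝟙    : Cong D (g 𝟙) 𝟙
      g-deg  : ∀ p x → Homogeneous p x → Σ (E n) λ y → Homogeneous p y × Cong D (g x) y
      gf     : ∀ x → Cong D (g (f x)) x
      fg     : ∀ y → Cong D' (f (g y)) y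

-- Write e₀ for the isthmus of {0} ⊕ P(G₀,G₁) and p for its common point.  The
-- substitution e_x ↦ e_x (x ∈ G₀), e_y ↦ e_y + (e₀ − e_p) (y ∈ G₁; so e_{p₁} ↦ e₀) of
-- exterior algebras has inverse e₀ ↦ e_{p₁}, e_x ↦ e_x, e_y ↦ e_y + (e_{p₀} − e_{p₁})
-- (y ∈ G₁ ∖ p₁).  Both send generators to degree-one elements v with ∂v = 1, hence are
-- graded algebra maps commuting with ∂; as the ideals are ∂-stable, it remains to map
-- e_S into the other ideal for every dependent S.  Translating the generators by a
-- degree-one t turns e_B into e_B + t ∧ ∂e_B, so dependent sets of a summand stay in
-- the ideal.  A circuit (C₀ ∖ p) ∪ (C₁ ∖ p) of the parallel connection goes to
-- ±X ∧ (Y + (e_{p₀} − e_{p₁}) ∧ ∂Y) = ±(X ∧ e_{p₀}) ∧ ∂Y ± X ∧ ∂(e_{p₁} ∧ Y),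
-- where X ∧ e_{p₀} = ±e_{C₀} and e_{p₁} ∧ Y = ±e_{C₁}.

module Submission where

open import Defs
open import Level using (_⊔_)
open import Algebra.Bundles using (CommutativeMonoid)
import Algebra.Solver.CommutativeMonoid as CommutativeMonoidSolver
open import Data.Bool using (true; false)
open import Data.Bool.Properties using (∨-identityʳ) renaming (_≟_ to _≟ᵇ_)
open import Data.Empty using (⊥-elim)
open import Data.Fin using (Fin; _↑ˡ_; _↑ʳ_; splitAt; punchIn; punchOut) renaming (zero to fz; suc to fs; _≟_ to _≟ᶠ_)
open import Data.Fin.Properties
  using (all?; ¬∀⟶∃¬; splitAt-↑ˡ; splitAt-↑ʳ; splitAt⁻¹-↑ˡ; splitAt⁻¹-↑ʳ; punchOut-cong; punchOut-punchIn;
         punchIn-punchOut; punchInᵢ≢i; punchOut-injective; ↑ˡ-injective; ↑ʳ-injective)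
  renaming (suc-injective to fs-injective)
open import Data.Fin.Subset using (Subset; ∣_∣; ⁅_⁆; ⊥; _∪_; _∈_; _∉_; _⊆_; _⊂_; _-_; _─_)
open import Data.Fin.Subset.Properties
  using (x∈p∪q⁺; x∈p∪q⁻; x∈⁅x⁆; x∈⁅y⁆⇒x≡y; ∉⊥; _∈?_; p─q⊆p; x∈p∧x≢y⇒x∈p-y; x∈p∧x∉q⇒x∈p─q;
         x∈p⇒∣p-x∣<∣p∣; nonempty?; Empty-unique; ⊆-antisym; ∪-identityˡ; ∪-comm)
open import Data.Nat using (ℕ; zero; suc; _+_; _<_; s≤s)
import Data.Nat.Properties as ℕ
open import Data.Product using (∃; _×_; _,_; proj₁; proj₂)
open import Data.Sum using (_⊎_; inj₁; inj₂; [_,_]′)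
open import Data.Vec using ([]; _∷_; here; there; _++_; take; drop)
open import Data.Vec.Properties using (≡-dec; take++drop≡id)
open import Function using (_∘_)
open import Function.Definitions using (Injective)
open import Relation.Binary.Bundles using (Setoid)
import Relation.Binary.Reasoning.Setoid as SetoidReasoning
open import Relation.Binary.PropositionalEquality as ≡ using (_≡_; _≢_)
open import Relation.Nullary using (¬_; yes; no)
open import Relation.Nullary.Decidable using (_→-dec_)

↑ˡ≢↑ʳ : ∀ {m n} (i : Fin m) (j : Fin n) → i ↑ˡ n ≢ m ↑ʳ j
↑ˡ≢↑ʳ {m} {n} i j eq with ≡.trans (≡.sym (splitAt-↑ˡ m i n)) (≡.trans (≡.cong (splitAt m) eq) (splitAt-↑ʳ m n j))
... | ()

↑-elim : ∀ {m n p} (P : Fin (m + n) → Set p) → (∀ i → P (i ↑ˡ n)) → (∀ j → P (m ↑ʳ j)) → ∀ k → P k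
↑-elim {m} P P↑ˡ P↑ʳ k with splitAt m k in eq
... | inj₁ i = ≡.subst P (splitAt⁻¹-↑ˡ eq) (P↑ˡ i)
... | inj₂ j = ≡.subst P (splitAt⁻¹-↑ʳ eq) (P↑ʳ j)

Disjoint : ∀ {n} → Subset n → Subset n → Set
Disjoint A B = ∀ {i} → i ∈ A → i ∉ B

Disjoint-sym : ∀ {n} {A B : Subset n} → Disjoint A B → Disjoint B A
Disjoint-sym d i∈B i∈A = d i∈A i∈B

Disjoint-tail : ∀ {n} {x y} {A B : Subset n} → Disjoint (x ∷ A) (y ∷ B) → Disjoint A B
Disjoint-tail d i∈A i∈B = d (there i∈A) (there i∈B)

∈-─⁻ : ∀ {n} (A B : Subset n) {i} → i ∈ A ─ B → i ∈ A × i ∉ B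
∈-─⁻ (_ ∷ A) (false ∷ B) here = here , λ ()
∈-─⁻ (_ ∷ A) (_ ∷ B) (there i∈) with ∈-─⁻ A B i∈
... | i∈A , i∉B = there i∈A , λ { (there i∈B) → i∉B i∈B }

Disjoint-─ : ∀ {n} (A B : Subset n) → Disjoint B (A ─ B)
Disjoint-─ A B i∈B i∈A─B = proj₂ (∈-─⁻ A B i∈A─B) i∈B

∈-minus⁻ : ∀ {n} (A : Subset n) p {i} → i ∈ A - p → i ∈ A × i ≢ p
∈-minus⁻ A p i∈ with ∈-─⁻ A ⁅ p ⁆ i∈
... | i∈A , i∉p = i∈A , λ { ≡.refl → i∉p (x∈⁅x⁆ p) }

⊆⇒∪─≡ : ∀ {n} {A B : Subset n} → B ⊆ A → B ∪ (A ─ B) ≡ A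
⊆⇒∪─≡ {A = A} {B} B⊆A = ⊆-antisym ⊆A A⊆
  where
  ⊆A : B ∪ (A ─ B) ⊆ A
  ⊆A i∈ with x∈p∪q⁻ B (A ─ B) i∈
  ... | inj₁ i∈B = B⊆A i∈B
  ... | inj₂ i∈A─B = p─q⊆p A B i∈A─B
  A⊆ : A ⊆ B ∪ (A ─ B)
  A⊆ {i} i∈A with i ∈? B
  ... | yes i∈B = x∈p∪q⁺ (inj₁ i∈B)
  ... | no i∉B = x∈p∪q⁺ {p = B} (inj₂ (x∈p∧x∉q⇒x∈p─q i∈A i∉B))

∈⇒-∪⁅⁆≡ : ∀ {n} {A : Subset n} {p} → p ∈ A → (A - p) ∪ ⁅ p ⁆ ≡ A
∈⇒-∪⁅⁆≡ {A = A} {p} p∈A = ⊆-antisym ⊆A A⊆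
  where
  ⊆A : (A - p) ∪ ⁅ p ⁆ ⊆ A
  ⊆A i∈ with x∈p∪q⁻ (A - p) ⁅ p ⁆ i∈
  ... | inj₁ i∈A-p = proj₁ (∈-minus⁻ A p i∈A-p)
  ... | inj₂ i∈p rewrite x∈⁅y⁆⇒x≡y p i∈p = p∈A
  A⊆ : A ⊆ (A - p) ∪ ⁅ p ⁆
  A⊆ {i} i∈A with i ≟ᶠ p
  ... | yes ≡.refl = x∈p∪q⁺ {p = A - p} (inj₂ (x∈⁅x⁆ p))
  ... | no i≢p = x∈p∪q⁺ (inj₁ (x∈p∧x≢y⇒x∈p-y i∈A i≢p))

Disjoint--⁅⁆ : ∀ {n} (A : Subset n) p → Disjoint (A - p) ⁅ p ⁆
Disjoint--⁅⁆ A p i∈A-p i∈p = proj₂ (∈-minus⁻ A p i∈A-p) (x∈⁅y⁆⇒x≡y p i∈p)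

image : ∀ {k m} → (Fin k → Fin m) → Subset k → Subset m
image φ []          = ⊥
image φ (true ∷ A)  = ⁅ φ fz ⁆ ∪ image (φ ∘ fs) A
image φ (false ∷ A) = image (φ ∘ fs) A

∈-image⁺ : ∀ {k m} (φ : Fin k → Fin m) {A i} → i ∈ A → φ i ∈ image φ A
∈-image⁺ φ {true ∷ A} here       = x∈p∪q⁺ (inj₁ (x∈⁅x⁆ (φ fz)))
∈-image⁺ φ {true ∷ A} (there i∈) = x∈p∪q⁺ {p = ⁅ φ fz ⁆} (inj₂ (∈-image⁺ (φ ∘ fs) i∈))
∈-image⁺ φ {false ∷ A} (there i∈) = ∈-image⁺ (φ ∘ fs) i∈

∈-image⁻ : ∀ {k m} (φ : Fin k → Fin m) (A : Subset k) {j} → j ∈ image φ A → ∃ λ i → i ∈ A × φ i ≡ j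
∈-image⁻ φ [] j∈ = ⊥-elim (∉⊥ j∈)
∈-image⁻ φ (true ∷ A) j∈ with x∈p∪q⁻ ⁅ φ fz ⁆ (image (φ ∘ fs) A) j∈
... | inj₁ j∈φ0 = fz , here , ≡.sym (x∈⁅y⁆⇒x≡y (φ fz) j∈φ0)
... | inj₂ j∈ʳ with ∈-image⁻ (φ ∘ fs) A j∈ʳ
...   | i , i∈A , eq = fs i , there i∈A , eq
∈-image⁻ φ (false ∷ A) j∈ with ∈-image⁻ (φ ∘ fs) A j∈
... | i , i∈A , eq = fs i , there i∈A , eq

image-mono : ∀ {k m} (φ : Fin k → Fin m) {A B} → A ⊆ B → image φ A ⊆ image φ B
image-mono φ {A} A⊆B j∈ with ∈-image⁻ φ A j∈
... | i , i∈A , ≡.refl = ∈-image⁺ φ (A⊆B i∈A)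

image-suc : ∀ {k m} (φ : Fin k → Fin m) (A : Subset k) → image (fs ∘ φ) A ≡ false ∷ image φ A
image-suc φ []          = ≡.refl
image-suc φ (true ∷ A)  = ≡.cong (⁅ fs (φ fz) ⁆ ∪_) (image-suc (φ ∘ fs) A)
image-suc φ (false ∷ A) = image-suc (φ ∘ fs) A

image-id : ∀ {k} (A : Subset k) → image (λ i → i) A ≡ A
image-id []          = ≡.refl
image-id (true ∷ A)  =
  ≡.trans (≡.cong (⁅ fz ⁆ ∪_) (≡.trans (image-suc (λ i → i) A) (≡.cong (false ∷_) (image-id A))))
          (≡.cong (true ∷_) (∪-identityˡ A))
image-id (false ∷ A) = ≡.trans (image-suc (λ i → i) A) (≡.cong (false ∷_) (image-id A))

image-↑ˡ : ∀ {m} k (A : Subset m) → image (_↑ˡ k) A ≡ A ++ ⊥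
image-↑ˡ k []          = ≡.refl
image-↑ˡ k (true ∷ A)  =
  ≡.trans (≡.cong (⁅ fz ⁆ ∪_) (≡.trans (image-suc (_↑ˡ k) A) (≡.cong (false ∷_) (image-↑ˡ k A))))
          (≡.cong (true ∷_) (∪-identityˡ _))
image-↑ˡ k (false ∷ A) = ≡.trans (image-suc (_↑ˡ k) A) (≡.cong (false ∷_) (image-↑ˡ k A))

image-↑ʳ : ∀ m {k} (B : Subset k) → image (m ↑ʳ_) B ≡ ⊥ {m} ++ B
image-↑ʳ zero    B = image-id B
image-↑ʳ (suc m) B = ≡.trans (image-suc (m ↑ʳ_) B) (≡.cong (false ∷_) (image-↑ʳ m B))

image-complete : ∀ {k m} (φ : Fin k → Fin m) (A : Subset k) → ∀ j → (j ∈ image φ A) ⇔ (∃ λ i → i ∈ A × φ i ≡ j)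
image-complete φ A j = ∈-image⁻ φ A , λ { (i , i∈A , ≡.refl) → ∈-image⁺ φ i∈A }

image-unique : ∀ {k m} {φ : Fin k → Fin m} {A T} → (∀ j → (j ∈ T) ⇔ (∃ λ i → i ∈ A × φ i ≡ j)) → T ≡ image φ A
image-unique {φ = φ} {A} {T} T≈ = ⊆-antisym
  (λ {j} j∈T → let (i , i∈A , eq) = proj₁ (T≈ j) j∈T in ≡.subst (_∈ image φ A) eq (∈-image⁺ φ i∈A))
  (λ {j} j∈ → proj₂ (T≈ j) (∈-image⁻ φ A j∈))

take-++ : ∀ {m k} (A : Subset m) (B : Subset k) → take m (A ++ B) ≡ A
take-++ []      B = ≡.refl
take-++ (x ∷ A) B = ≡.cong (x ∷_) (take-++ A B)

drop-++ : ∀ {m k} (A : Subset m) (B : Subset k) → drop m (A ++ B) ≡ B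
drop-++ []      B = ≡.refl
drop-++ (x ∷ A) B = drop-++ A B

++⊥-∪-⊥++ : ∀ {m k} (A : Subset m) (B : Subset k) → (A ++ ⊥) ∪ (⊥ ++ B) ≡ A ++ B
++⊥-∪-⊥++ []      B = ∪-identityˡ B
++⊥-∪-⊥++ (x ∷ A) B = ≡.cong₂ _∷_ (∨-identityʳ x) (++⊥-∪-⊥++ A B)

take-image-↑ˡ : ∀ {m} n (A : Subset m) → take m (image (_↑ˡ n) A) ≡ A
take-image-↑ˡ n A = ≡.trans (≡.cong (take _) (image-↑ˡ n A)) (take-++ A (⊥ {n = n}))

drop-image-↑ʳ : ∀ m {n} (B : Subset n) → drop m (image (m ↑ʳ_) B) ≡ B
drop-image-↑ʳ m B = ≡.trans (≡.cong (drop m) (image-↑ʳ m B)) (drop-++ (⊥ {n = m}) B)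

image-↑ˡ-∪-image-↑ʳ : ∀ m {n} (S : Subset (m + n)) → image (_↑ˡ n) (take m S) ∪ image (m ↑ʳ_) (drop m S) ≡ S
image-↑ˡ-∪-image-↑ʳ m {n} S =
  ≡.trans (≡.cong₂ _∪_ (image-↑ˡ n (take m S)) (image-↑ʳ m (drop m S)))
          (≡.trans (++⊥-∪-⊥++ (take m S) (drop m S)) (take++drop≡id m S))

Disjoint-image-↑ˡ-↑ʳ : ∀ {m n} (A : Subset m) (B : Subset n) → Disjoint (image (_↑ˡ n) A) (image (m ↑ʳ_) B)
Disjoint-image-↑ˡ-↑ʳ A B k∈ˡ k∈ʳ with ∈-image⁻ _ A k∈ˡ | ∈-image⁻ _ B k∈ʳ
... | i , _ , ≡.refl | j , _ , eq = ↑ˡ≢↑ʳ i j (≡.sym eq)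

module _ {n} (M : Matroid n) where

  private
    circuit⊆-bounded : ∀ k A → ∣ A ∣ < k → Dependent M A → ∃ λ C → Circuit M C × C ⊆ A
    circuit⊆-bounded (suc k) A (s≤s ∣A∣≤k) dep
      with all? (λ x → (x ∈? A) →-dec indep? M (A - x))
    ... | yes minimal = A , (dep , proper⇒indep) , (λ i∈ → i∈)
      where
      proper⇒indep : ∀ D → D ⊂ A → Indep M D
      proper⇒indep D (D⊆A , x , x∈A , x∉D) =
        hereditary M (λ {y} y∈D → x∈p∧x≢y⇒x∈p-y (D⊆A y∈D) (λ { ≡.refl → x∉D y∈D })) (minimal x x∈A)
    ... | no ¬minimal with ¬∀⟶∃¬ _ _ (λ x → (x ∈? A) →-dec indep? M (A - x)) ¬minimal
    ...   | x , ¬[x∈A→indep] with x ∈? A | indep? M (A - x)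
    ...     | no x∉A     | _       = ⊥-elim (¬[x∈A→indep] (λ x∈A → ⊥-elim (x∉A x∈A)))
    ...     | yes _      | yes ind = ⊥-elim (¬[x∈A→indep] (λ _ → ind))
    ...     | yes x∈A    | no dep′
      with circuit⊆-bounded k (A - x) (ℕ.≤-trans (x∈p⇒∣p-x∣<∣p∣ x∈A) ∣A∣≤k) dep′
    ...       | C , circuit , C⊆ = C , circuit , (λ i∈ → p─q⊆p A ⁅ x ⁆ (C⊆ i∈))

  dependent⇒circuit⊆ : ∀ {A} → Dependent M A → ∃ λ C → Circuit M C × C ⊆ A
  dependent⇒circuit⊆ {A} = circuit⊆-bounded (suc ∣ A ∣) A (s≤s ℕ.≤-refl)

  dependent⇒nonempty : ∀ {A} → Dependent M A → ∃ λ i → i ∈ A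
  dependent⇒nonempty {A} dep with nonempty? A
  ... | yes ne = ne
  ... | no empty = ⊥-elim (dep (≡.subst (Indep M) (≡.sym (Empty-unique empty)) (indep-⊥ M)))

module Exterior {c ℓ} (K : Field c ℓ) where
  open Field K renaming (_+_ to _+ᴷ_) hiding (_-_)
  open import Algebra.Properties.Ring ring
    using (-0#≈0#; -‿involutive; -‿+-comm; -‿distribˡ-*; -‿distribʳ-*; x∙y⁻¹≈ε⇒x≈y)
  open import Algebra.Properties.CommutativeSemigroup +-commutativeSemigroup using (interchange)
  open import Algebra.Properties.CommutativeSemigroup *-commutativeSemigroup using (x∙yz≈y∙xz)
  open OS K renaming ( _⊕_ to infixl 6 _⊕_ ; _⊖_ to infixl 6 _⊖_ ; _⊙_ to infixr 7 _⊙_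
                     ; _∧_ to infixl 8 _∧_ ; _≋_ to infix 4 _≋_ )

  ≋-refl : ∀ {n} {x : E n} → x ≋ x
  ≋-refl _ = refl

  ≋-sym : ∀ {n} {x y : E n} → x ≋ y → y ≋ x
  ≋-sym p S = sym (p S)

  ≋-trans : ∀ {n} {x y z : E n} → x ≋ y → y ≋ z → x ≋ z
  ≋-trans p q S = trans (p S) (q S)

  ≋-setoid : ℕ → Setoid c ℓ
  ≋-setoid n = record
    { Carrier = E n ; _≈_ = _≋_
    ; isEquivalence = record { refl = ≋-refl ; sym = ≋-sym ; trans = ≋-trans } }

  module ≋-Reasoning (n : ℕ) = SetoidReasoning (≋-setoid n)

  neg : ∀ {n} → E n → E n
  neg x S = - x S

  ⊕-cong : ∀ {n} {x x′ y y′ : E n} → x ≋ x′ → y ≋ y′ → x ⊕ y ≋ x′ ⊕ y′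
  ⊕-cong p q S = +-cong (p S) (q S)

  ⊕-congˡ : ∀ {n} (x : E n) {y y′} → y ≋ y′ → x ⊕ y ≋ x ⊕ y′
  ⊕-congˡ x = ⊕-cong ≋-refl

  ⊕-congʳ : ∀ {n} (y : E n) {x x′} → x ≋ x′ → x ⊕ y ≋ x′ ⊕ y
  ⊕-congʳ y p = ⊕-cong p ≋-refl

  ⊕-comm : ∀ {n} (x y : E n) → x ⊕ y ≋ y ⊕ x
  ⊕-comm x y S = +-comm _ _

  ⊕-assoc : ∀ {n} (x y z : E n) → x ⊕ y ⊕ z ≋ x ⊕ (y ⊕ z)
  ⊕-assoc x y z S = +-assoc _ _ _

  ⊕-interchange : ∀ {n} (x y z w : E n) → (x ⊕ y) ⊕ (z ⊕ w) ≋ (x ⊕ z) ⊕ (y ⊕ w)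
  ⊕-interchange x y z w S = interchange _ _ _ _

  ⊕-identityˡ : ∀ {n} (x : E n) → 𝟘 ⊕ x ≋ x
  ⊕-identityˡ x S = +-identityˡ _

  ⊕-identityʳ : ∀ {n} (x : E n) → x ⊕ 𝟘 ≋ x
  ⊕-identityʳ x S = +-identityʳ _

  ⊕-inverseʳ : ∀ {n} (x : E n) → x ⊕ neg x ≋ 𝟘
  ⊕-inverseʳ x S = -‿inverseʳ _

  ⊖≋𝟘⇒≋ : ∀ {n} {x y : E n} → x ⊖ y ≋ 𝟘 → x ≋ y
  ⊖≋𝟘⇒≋ {x = x} {y} p S = x∙y⁻¹≈ε⇒x≈y (x S) (y S) (p S)

  ⊕-commutativeMonoid : ℕ → CommutativeMonoid c ℓ
  ⊕-commutativeMonoid n = record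
    { Carrier = E n ; _≈_ = _≋_ ; _∙_ = _⊕_ ; ε = 𝟘
    ; isCommutativeMonoid = record
      { isMonoid = record
        { isSemigroup = record
          { isMagma = record { isEquivalence = Setoid.isEquivalence (≋-setoid n) ; ∙-cong = ⊕-cong }
          ; assoc = ⊕-assoc }
        ; identity = ⊕-identityˡ , ⊕-identityʳ }
      ; comm = ⊕-comm } }

  module ⊕-Solver (n : ℕ) = CommutativeMonoidSolver (⊕-commutativeMonoid n) renaming (_⊕_ to _⊞_)

  neg-cong : ∀ {n} {x y : E n} → x ≋ y → neg x ≋ neg y
  neg-cong p S = -‿cong (p S)

  neg-involutive : ∀ {n} (x : E n) → neg (neg x) ≋ x
  neg-involutive x S = -‿involutive _

  neg-⊕ : ∀ {n} (x y : E n) → neg (x ⊕ y) ≋ neg x ⊕ neg y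
  neg-⊕ x y S = sym (-‿+-comm _ _)

  x⊕[y⊖x]≋y : ∀ {n} (x y : E n) → x ⊕ (y ⊖ x) ≋ y
  x⊕[y⊖x]≋y {n} x y = begin
    x ⊕ (y ⊖ x)       ≈⟨ solve 3 (λ p q r → (p ⊞ (q ⊞ r)) ⊜ ((p ⊞ r) ⊞ q)) ≋-refl x y (neg x) ⟩
    (x ⊕ neg x) ⊕ y   ≈⟨ ≋-trans (⊕-congʳ y (⊕-inverseʳ x)) (⊕-identityˡ y) ⟩
    y                 ∎
    where
    open ≋-Reasoning n
    open ⊕-Solver n using (solve; _⊜_; _⊞_)

  [x⊕[y⊖z]]⊕[z⊖y]≋x : ∀ {n} (x y z : E n) → (x ⊕ (y ⊖ z)) ⊕ (z ⊖ y) ≋ x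
  [x⊕[y⊖z]]⊕[z⊖y]≋x {n} x y z = begin
    (x ⊕ (y ⊖ z)) ⊕ (z ⊖ y)
      ≈⟨ solve 5 (λ p q q′ r r′ → ((p ⊞ (q ⊞ r′)) ⊞ (r ⊞ q′)) ⊜ (p ⊞ ((q ⊞ q′) ⊞ (r ⊞ r′))))
               ≋-refl x y (neg y) z (neg z) ⟩
    x ⊕ ((y ⊕ neg y) ⊕ (z ⊕ neg z))
      ≈⟨ ≋-trans (⊕-congˡ x (≋-trans (⊕-cong (⊕-inverseʳ y) (⊕-inverseʳ z)) (⊕-identityˡ 𝟘))) (⊕-identityʳ x) ⟩
    x ∎
    where
    open ≋-Reasoning n
    open ⊕-Solver n using (solve; _⊜_; _⊞_)

  [x⊕t]⊕[y⊖[y⊕t]]≋x : ∀ {n} (x t y : E n) → (x ⊕ t) ⊕ (y ⊖ (y ⊕ t)) ≋ x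
  [x⊕t]⊕[y⊖[y⊕t]]≋x {n} x t y = begin
    (x ⊕ t) ⊕ (y ⊖ (y ⊕ t))
      ≈⟨ ⊕-congˡ (x ⊕ t) (⊕-congˡ y (neg-⊕ y t)) ⟩
    (x ⊕ t) ⊕ (y ⊕ (neg y ⊕ neg t))
      ≈⟨ solve 5 (λ p r r′ q q′ → ((p ⊞ r) ⊞ (q ⊞ (q′ ⊞ r′))) ⊜ (p ⊞ ((q ⊞ q′) ⊞ (r ⊞ r′))))
               ≋-refl x t (neg t) y (neg y) ⟩
    x ⊕ ((y ⊕ neg y) ⊕ (t ⊕ neg t))
      ≈⟨ ≋-trans (⊕-congˡ x (≋-trans (⊕-cong (⊕-inverseʳ y) (⊕-inverseʳ t)) (⊕-identityˡ 𝟘))) (⊕-identityʳ x) ⟩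
    x ∎
    where
    open ≋-Reasoning n
    open ⊕-Solver n using (solve; _⊜_; _⊞_)

  ⊙-cong : ∀ {n} {r s} {x y : E n} → r ≈ s → x ≋ y → r ⊙ x ≋ s ⊙ y
  ⊙-cong p q S = *-cong p (q S)

  ⊙-congˡ : ∀ {n} r {x y : E n} → x ≋ y → r ⊙ x ≋ r ⊙ y
  ⊙-congˡ r = ⊙-cong refl

  ⊙-distribˡ : ∀ {n} r (x y : E n) → r ⊙ (x ⊕ y) ≋ r ⊙ x ⊕ r ⊙ y
  ⊙-distribˡ r x y S = distribˡ _ _ _

  ⊙-distribʳ : ∀ {n} r s (x : E n) → (r +ᴷ s) ⊙ x ≋ r ⊙ x ⊕ s ⊙ x
  ⊙-distribʳ r s x S = distribʳ _ _ _

  ⊙-zeroʳ : ∀ {n} r → r ⊙ 𝟘 {n} ≋ 𝟘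
  ⊙-zeroʳ r S = zeroʳ _

  ⊙-zeroˡ : ∀ {n} (x : E n) → 0# ⊙ x ≋ 𝟘
  ⊙-zeroˡ x S = zeroˡ _

  ⊙-identityˡ : ∀ {n} (x : E n) → 1# ⊙ x ≋ x
  ⊙-identityˡ x S = *-identityˡ _

  ⊙-⊙ : ∀ {n} r s (x : E n) → r ⊙ s ⊙ x ≋ (r * s) ⊙ x
  ⊙-⊙ r s x S = sym (*-assoc _ _ _)

  neg-⊙ : ∀ {n} r (x : E n) → (- r) ⊙ x ≋ neg (r ⊙ x)
  neg-⊙ r x S = sym (-‿distribˡ-* _ _)

  neg≋-1⊙ : ∀ {n} (x : E n) → neg x ≋ (- 1#) ⊙ x
  neg≋-1⊙ x S = trans (-‿cong (sym (*-identityˡ _))) (-‿distribˡ-* _ _)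

  signPow-cong : ∀ k {r s} → r ≈ s → signPow k r ≈ signPow k s
  signPow-cong zero    p = p
  signPow-cong (suc k) p = -‿cong (signPow-cong k p)

  signPow-+ : ∀ k r s → signPow k (r +ᴷ s) ≈ signPow k r +ᴷ signPow k s
  signPow-+ zero    r s = refl
  signPow-+ (suc k) r s = trans (-‿cong (signPow-+ k r s)) (sym (-‿+-comm _ _))

  signPow-* : ∀ k r s → signPow k (r * s) ≈ r * signPow k s
  signPow-* zero    r s = refl
  signPow-* (suc k) r s = trans (-‿cong (signPow-* k r s)) (-‿distribʳ-* _ _)

  signPow-neg : ∀ k r → signPow k (- r) ≈ - signPow k r
  signPow-neg zero    r = refl
  signPow-neg (suc k) r = -‿cong (signPow-neg k r)

  signPow-0# : ∀ k → signPow k 0# ≈ 0#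
  signPow-0# zero    = refl
  signPow-0# (suc k) = trans (-‿cong (signPow-0# k)) -0#≈0#

  σ-cong : ∀ {n} {x y : E n} → x ≋ y → σ x ≋ σ y
  σ-cong p S = signPow-cong ∣ S ∣ (p S)

  σ-⊕ : ∀ {n} (x y : E n) → σ (x ⊕ y) ≋ σ x ⊕ σ y
  σ-⊕ x y S = signPow-+ ∣ S ∣ _ _

  σ-⊙ : ∀ {n} r (x : E n) → σ (r ⊙ x) ≋ r ⊙ σ x
  σ-⊙ r x S = signPow-* ∣ S ∣ _ _

  σ-𝟙 : ∀ {n} → σ (𝟙 {n}) ≋ 𝟙
  σ-𝟙 {zero}  []          = refl
  σ-𝟙 {suc n} (true ∷ U)  = trans (-‿cong (signPow-0# ∣ U ∣)) -0#≈0#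
  σ-𝟙 {suc n} (false ∷ U) = σ-𝟙 {n} U

  -- Exterior product

  ∧-cong : ∀ {n} {x x′ y y′ : E n} → x ≋ x′ → y ≋ y′ → x ∧ y ≋ x′ ∧ y′
  ∧-cong {zero}  p q []          = *-cong (p []) (q [])
  ∧-cong {suc n} p q (true ∷ U)  =
    +-cong (∧-cong (λ S → p (true ∷ S)) (λ S → q (false ∷ S)) U)
           (∧-cong (σ-cong (λ S → p (false ∷ S))) (λ S → q (true ∷ S)) U)
  ∧-cong {suc n} p q (false ∷ U) = ∧-cong (λ S → p (false ∷ S)) (λ S → q (false ∷ S)) U

  ∧-congˡ : ∀ {n} (x : E n) {y y′} → y ≋ y′ → x ∧ y ≋ x ∧ y′
  ∧-congˡ x = ∧-cong ≋-refl

  ∧-congʳ : ∀ {n} (y : E n) {x x′} → x ≋ x′ → x ∧ y ≋ x′ ∧ y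
  ∧-congʳ y p = ∧-cong p ≋-refl

  ∧-distribˡ : ∀ {n} (x y z : E n) → x ∧ (y ⊕ z) ≋ x ∧ y ⊕ x ∧ z
  ∧-distribˡ {zero}  x y z []          = distribˡ _ _ _
  ∧-distribˡ {suc n} x y z (true ∷ U)  =
    trans (+-cong (∧-distribˡ (tl x) (fl y) (fl z) U) (∧-distribˡ (σ (fl x)) (tl y) (tl z) U))
          (interchange _ _ _ _)
  ∧-distribˡ {suc n} x y z (false ∷ U) = ∧-distribˡ (fl x) (fl y) (fl z) U

  ∧-distribʳ : ∀ {n} (x y z : E n) → (x ⊕ y) ∧ z ≋ x ∧ z ⊕ y ∧ z
  ∧-distribʳ {zero}  x y z []          = distribʳ _ _ _
  ∧-distribʳ {suc n} x y z (true ∷ U)  =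
    trans (+-cong (∧-distribʳ (tl x) (tl y) (fl z) U)
                  (trans (∧-congʳ (tl z) (σ-⊕ (fl x) (fl y)) U) (∧-distribʳ (σ (fl x)) (σ (fl y)) (tl z) U)))
          (interchange _ _ _ _)
  ∧-distribʳ {suc n} x y z (false ∷ U) = ∧-distribʳ (fl x) (fl y) (fl z) U

  ∧-⊙ʳ : ∀ {n} r (x y : E n) → x ∧ (r ⊙ y) ≋ r ⊙ (x ∧ y)
  ∧-⊙ʳ {zero}  r x y []          = x∙yz≈y∙xz _ _ _
  ∧-⊙ʳ {suc n} r x y (true ∷ U)  =
    trans (+-cong (∧-⊙ʳ r (tl x) (fl y) U) (∧-⊙ʳ r (σ (fl x)) (tl y) U)) (sym (distribˡ _ _ _))
  ∧-⊙ʳ {suc n} r x y (false ∷ U) = ∧-⊙ʳ r (fl x) (fl y) U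

  ∧-⊙ˡ : ∀ {n} r (x y : E n) → (r ⊙ x) ∧ y ≋ r ⊙ (x ∧ y)
  ∧-⊙ˡ {zero}  r x y []          = *-assoc _ _ _
  ∧-⊙ˡ {suc n} r x y (true ∷ U)  =
    trans (+-cong (∧-⊙ˡ r (tl x) (fl y) U)
                  (trans (∧-congʳ (tl y) (σ-⊙ r (fl x)) U) (∧-⊙ˡ r (σ (fl x)) (tl y) U)))
          (sym (distribˡ _ _ _))
  ∧-⊙ˡ {suc n} r x y (false ∷ U) = ∧-⊙ˡ r (fl x) (fl y) U

  ∧-negˡ : ∀ {n} (x y : E n) → neg x ∧ y ≋ neg (x ∧ y)
  ∧-negˡ x y = ≋-trans (∧-congʳ y (neg≋-1⊙ x)) (≋-trans (∧-⊙ˡ _ x y) (≋-sym (neg≋-1⊙ _)))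

  ∧-negʳ : ∀ {n} (x y : E n) → x ∧ neg y ≋ neg (x ∧ y)
  ∧-negʳ x y = ≋-trans (∧-congˡ x (neg≋-1⊙ y)) (≋-trans (∧-⊙ʳ _ x y) (≋-sym (neg≋-1⊙ _)))

  ∧-zeroˡ : ∀ {n} (y : E n) → 𝟘 ∧ y ≋ 𝟘
  ∧-zeroˡ y = ≋-trans (∧-congʳ y (≋-sym (⊙-zeroˡ 𝟘))) (≋-trans (∧-⊙ˡ _ 𝟘 y) (⊙-zeroˡ _))

  ∧-zeroʳ : ∀ {n} (x : E n) → x ∧ 𝟘 ≋ 𝟘
  ∧-zeroʳ x = ≋-trans (∧-congˡ x (≋-sym (⊙-zeroˡ 𝟘))) (≋-trans (∧-⊙ʳ _ x 𝟘) (⊙-zeroˡ _))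

  σ-∧ : ∀ {n} (x y : E n) → σ (x ∧ y) ≋ σ x ∧ σ y
  σ-∧ {zero}  x y []          = refl
  σ-∧ {suc n} x y (true ∷ U)  =
    trans (-‿cong (signPow-+ ∣ U ∣ _ _))
    (trans (-‿cong (+-cong (σ-∧ (tl x) (fl y) U) (σ-∧ (σ (fl x)) (tl y) U)))
    (trans (sym (-‿+-comm _ _))
    (sym (+-cong (∧-negˡ (σ (tl x)) (σ (fl y)) U) (∧-negʳ (σ (σ (fl x))) (σ (tl y)) U)))))
  σ-∧ {suc n} x y (false ∷ U) = σ-∧ (fl x) (fl y) U

  ∧-assoc : ∀ {n} (x y z : E n) → (x ∧ y) ∧ z ≋ x ∧ (y ∧ z)
  ∧-assoc {zero}  x y z []          = *-assoc _ _ _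
  ∧-assoc {suc n} x y z (true ∷ U)  = chain U
    where
    open ≋-Reasoning n
    chain : (tl x ∧ fl y ⊕ σ (fl x) ∧ tl y) ∧ fl z ⊕ σ (fl x ∧ fl y) ∧ tl z
            ≋ tl x ∧ (fl y ∧ fl z) ⊕ σ (fl x) ∧ (tl y ∧ fl z ⊕ σ (fl y) ∧ tl z)
    chain = begin
      (tl x ∧ fl y ⊕ σ (fl x) ∧ tl y) ∧ fl z ⊕ σ (fl x ∧ fl y) ∧ tl z
        ≈⟨ ⊕-cong (∧-distribʳ _ _ _) (∧-congʳ (tl z) (σ-∧ _ _)) ⟩
      ((tl x ∧ fl y) ∧ fl z ⊕ (σ (fl x) ∧ tl y) ∧ fl z) ⊕ (σ (fl x) ∧ σ (fl y)) ∧ tl z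
        ≈⟨ ⊕-assoc _ _ _ ⟩
      (tl x ∧ fl y) ∧ fl z ⊕ ((σ (fl x) ∧ tl y) ∧ fl z ⊕ (σ (fl x) ∧ σ (fl y)) ∧ tl z)
        ≈⟨ ⊕-cong (∧-assoc _ _ _) (⊕-cong (∧-assoc _ _ _) (∧-assoc _ _ _)) ⟩
      tl x ∧ (fl y ∧ fl z) ⊕ (σ (fl x) ∧ (tl y ∧ fl z) ⊕ σ (fl x) ∧ (σ (fl y) ∧ tl z))
        ≈⟨ ⊕-cong ≋-refl (≋-sym (∧-distribˡ _ _ _)) ⟩
      tl x ∧ (fl y ∧ fl z) ⊕ σ (fl x) ∧ (tl y ∧ fl z ⊕ σ (fl y) ∧ tl z) ∎
  ∧-assoc {suc n} x y z (false ∷ U) = ∧-assoc (fl x) (fl y) (fl z) U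

  ∧-identityˡ : ∀ {n} (x : E n) → 𝟙 ∧ x ≋ x
  ∧-identityˡ {zero}  x []          = *-identityˡ _
  ∧-identityˡ {suc n} x (true ∷ U)  =
    trans (+-cong (∧-zeroˡ (fl x) U) (trans (∧-congʳ (tl x) σ-𝟙 U) (∧-identityˡ (tl x) U))) (+-identityˡ _)
  ∧-identityˡ {suc n} x (false ∷ U) = ∧-identityˡ (fl x) U

  ∧-identityʳ : ∀ {n} (x : E n) → x ∧ 𝟙 ≋ x
  ∧-identityʳ {zero}  x []          = *-identityʳ _
  ∧-identityʳ {suc n} x (true ∷ U)  = trans (+-cong (∧-identityʳ (tl x) U) (∧-zeroʳ (σ (fl x)) U)) (+-identityʳ _)
  ∧-identityʳ {suc n} x (false ∷ U) = ∧-identityʳ (fl x) U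

  ⊙-𝟙-∧ : ∀ {n} r (x : E n) → (r ⊙ 𝟙) ∧ x ≋ r ⊙ x
  ⊙-𝟙-∧ r x = ≋-trans (∧-⊙ˡ r 𝟙 x) (⊙-congˡ r (∧-identityˡ x))

  ∧-⊙-𝟙 : ∀ {n} r (x : E n) → x ∧ (r ⊙ 𝟙) ≋ r ⊙ x
  ∧-⊙-𝟙 r x = ≋-trans (∧-⊙ʳ r x 𝟙) (⊙-congˡ r (∧-identityʳ x))

  -- Boundary map

  ∂-cong : ∀ {n} {x y : E n} → x ≋ y → ∂ x ≋ ∂ y
  ∂-cong {zero}  p []          = refl
  ∂-cong {suc n} p (true ∷ U)  = -‿cong (∂-cong (λ S → p (true ∷ S)) U)
  ∂-cong {suc n} p (false ∷ U) = +-cong (p (true ∷ U)) (∂-cong (λ S → p (false ∷ S)) U)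

  ∂-⊕ : ∀ {n} (x y : E n) → ∂ (x ⊕ y) ≋ ∂ x ⊕ ∂ y
  ∂-⊕ {zero}  x y []          = sym (+-identityˡ _)
  ∂-⊕ {suc n} x y (true ∷ U)  = trans (-‿cong (∂-⊕ (tl x) (tl y) U)) (sym (-‿+-comm _ _))
  ∂-⊕ {suc n} x y (false ∷ U) = trans (+-congˡ (∂-⊕ (fl x) (fl y) U)) (interchange _ _ _ _)

  ∂-⊙ : ∀ {n} r (x : E n) → ∂ (r ⊙ x) ≋ r ⊙ ∂ x
  ∂-⊙ {zero}  r x []          = sym (zeroʳ r)
  ∂-⊙ {suc n} r x (true ∷ U)  = trans (-‿cong (∂-⊙ r (tl x) U)) (-‿distribʳ-* _ _)
  ∂-⊙ {suc n} r x (false ∷ U) = trans (+-congˡ (∂-⊙ r (fl x) U)) (sym (distribˡ _ _ _))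

  ∂-neg : ∀ {n} (x : E n) → ∂ (neg x) ≋ neg (∂ x)
  ∂-neg x = ≋-trans (∂-cong (neg≋-1⊙ x)) (≋-trans (∂-⊙ _ x) (≋-sym (neg≋-1⊙ _)))

  ∂-𝟘 : ∀ {n} → ∂ (𝟘 {n}) ≋ 𝟘
  ∂-𝟘 = ≋-trans (∂-cong (≋-sym (⊙-zeroˡ 𝟘))) (≋-trans (∂-⊙ _ 𝟘) (⊙-zeroˡ _))

  ∂-𝟙 : ∀ {n} → ∂ (𝟙 {n}) ≋ 𝟘
  ∂-𝟙 {zero}  []          = refl
  ∂-𝟙 {suc n} (true ∷ U)  = trans (-‿cong (∂-𝟘 {n} U)) -0#≈0#
  ∂-𝟙 {suc n} (false ∷ U) = trans (+-identityˡ _) (∂-𝟙 {n} U)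

  ∂-gen : ∀ {n} (i : Fin n) → ∂ (gen i) ≋ 𝟙
  ∂-gen {suc n} fz     (true ∷ U)  = trans (-‿cong (∂-𝟙 {n} U)) -0#≈0#
  ∂-gen {suc n} fz     (false ∷ U) = trans (+-congˡ (∂-𝟘 {n} U)) (+-identityʳ _)
  ∂-gen {suc n} (fs i) (true ∷ U)  = trans (-‿cong (∂-𝟘 {n} U)) -0#≈0#
  ∂-gen {suc n} (fs i) (false ∷ U) = trans (+-identityˡ _) (∂-gen i U)

  ∂-σ : ∀ {n} (x : E n) → ∂ (σ x) ≋ neg (σ (∂ x))
  ∂-σ {zero}  x []          = sym -0#≈0#
  ∂-σ {suc n} x (true ∷ U)  =
    trans (-‿cong (∂-neg (σ (tl x)) U)) (trans (-‿involutive _) (trans (∂-σ (tl x) U)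
      (sym (trans (-‿involutive _) (signPow-neg ∣ U ∣ _)))))
  ∂-σ {suc n} x (false ∷ U) =
    trans (+-congˡ (∂-σ (fl x) U)) (trans (-‿+-comm _ _) (-‿cong (sym (signPow-+ ∣ U ∣ _ _))))

  ∂-∂ : ∀ {n} (x : E n) → ∂ (∂ x) ≋ 𝟘
  ∂-∂ {zero}  x []          = refl
  ∂-∂ {suc n} x (true ∷ U)  = trans (-‿cong (∂-neg (∂ (tl x)) U)) (trans (-‿involutive _) (∂-∂ (tl x) U))
  ∂-∂ {suc n} x (false ∷ U) =
    trans (+-congˡ (trans (∂-⊕ (tl x) (∂ (fl x)) U) (trans (+-congˡ (∂-∂ (fl x) U)) (+-identityʳ _))))
          (-‿inverseˡ _)

  ∂-∧ : ∀ {n} (x y : E n) → ∂ (x ∧ y) ≋ ∂ x ∧ y ⊕ σ x ∧ ∂ y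
  ∂-∧ {zero}  x y []          = sym (trans (+-cong (zeroˡ _) (zeroʳ _)) (+-identityˡ _))
  ∂-∧ {suc n} x y (true ∷ U)  = chain U
    where
    open ≋-Reasoning n
    open ⊕-Solver n using (solve; _⊜_; _⊞_)
    a = tl x ; b = fl x ; c′ = tl y ; d = fl y
    A₁ = neg (∂ a ∧ d) ; A₂ = neg (σ a ∧ ∂ d) ; A₃ = σ (∂ b) ∧ c′ ; A₄ = neg (σ (σ b) ∧ ∂ c′)
    B = σ a ∧ c′
    chain : neg (∂ (a ∧ d ⊕ σ b ∧ c′))
            ≋ (neg (∂ a) ∧ d ⊕ σ (a ⊕ ∂ b) ∧ c′) ⊕ (neg (σ a) ∧ (c′ ⊕ ∂ d) ⊕ σ (σ b) ∧ neg (∂ c′))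
    chain = begin
      neg (∂ (a ∧ d ⊕ σ b ∧ c′))
        ≈⟨ neg-cong (≋-trans (∂-⊕ _ _) (⊕-cong (∂-∧ a d) (∂-∧ (σ b) c′))) ⟩
      neg ((∂ a ∧ d ⊕ σ a ∧ ∂ d) ⊕ (∂ (σ b) ∧ c′ ⊕ σ (σ b) ∧ ∂ c′))
        ≈⟨ ≋-trans (neg-⊕ _ _) (⊕-cong (neg-⊕ _ _) (≋-trans (neg-⊕ _ _) (⊕-cong ∂σb∧c′ ≋-refl))) ⟩
      (A₁ ⊕ A₂) ⊕ (A₃ ⊕ A₄)
        ≈⟨ ≋-sym (≋-trans (⊕-cong (⊕-inverseʳ B) ≋-refl) (⊕-identityˡ _)) ⟩
      (B ⊕ neg B) ⊕ ((A₁ ⊕ A₂) ⊕ (A₃ ⊕ A₄))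
        ≈⟨ solve 6 (λ b b′ a₁ a₂ a₃ a₄ → ((b ⊞ b′) ⊞ ((a₁ ⊞ a₂) ⊞ (a₃ ⊞ a₄)))
                                         ⊜ ((a₁ ⊞ (b ⊞ a₃)) ⊞ ((b′ ⊞ a₂) ⊞ a₄))) ≋-refl
                 B (neg B) A₁ A₂ A₃ A₄ ⟩
      (A₁ ⊕ (B ⊕ A₃)) ⊕ ((neg B ⊕ A₂) ⊕ A₄)
        ≈⟨ ≋-sym (⊕-cong (⊕-cong (∧-negˡ _ _) (≋-trans (∧-congʳ c′ (σ-⊕ a (∂ b))) (∧-distribʳ _ _ _)))
                         (⊕-cong (≋-trans (∧-negˡ _ _) (≋-trans (neg-cong (∧-distribˡ _ _ _)) (neg-⊕ _ _)))
                                 (∧-negʳ _ _))) ⟩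
      (neg (∂ a) ∧ d ⊕ σ (a ⊕ ∂ b) ∧ c′) ⊕ (neg (σ a) ∧ (c′ ⊕ ∂ d) ⊕ σ (σ b) ∧ neg (∂ c′)) ∎
      where
      ∂σb∧c′ : neg (∂ (σ b) ∧ c′) ≋ A₃
      ∂σb∧c′ = ≋-trans (neg-cong (≋-trans (∧-congʳ c′ (∂-σ b)) (∧-negˡ _ _))) (neg-involutive _)
  ∂-∧ {suc n} x y (false ∷ U) =
    trans (+-congˡ (∂-∧ (fl x) (fl y) U))
    (trans (interchange _ _ _ _)
    (sym (+-cong (∧-distribʳ (tl x) (∂ (fl x)) (fl y) U) (∧-distribˡ (σ (fl x)) (tl y) (∂ (fl y)) U))))

  -- x is homogeneous of degree p − k, phrased without truncated subtraction;
  -- the offset k counts generators already split off by tl.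
  Homogeneous⁺ : ∀ {n} → ℕ → ℕ → E n → Set ℓ
  Homogeneous⁺ k p x = ∀ S → ¬ (k + ∣ S ∣ ≡ p) → x S ≈ 0#

  Linear : ∀ {n} → E n → Set ℓ
  Linear = Homogeneous 1

  Homogeneous⁺-⊕ : ∀ {n k p} {x y : E n} → Homogeneous⁺ k p x → Homogeneous⁺ k p y → Homogeneous⁺ k p (x ⊕ y)
  Homogeneous⁺-⊕ hx hy S ne = trans (+-cong (hx S ne) (hy S ne)) (+-identityˡ _)

  Homogeneous⁺-neg : ∀ {n k p} {x : E n} → Homogeneous⁺ k p x → Homogeneous⁺ k p (neg x)
  Homogeneous⁺-neg hx S ne = trans (-‿cong (hx S ne)) -0#≈0#

  Homogeneous⁺-σ : ∀ {n k p} {x : E n} → Homogeneous⁺ k p x → Homogeneous⁺ k p (σ x)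
  Homogeneous⁺-σ hx S ne = trans (signPow-cong ∣ S ∣ (hx S ne)) (signPow-0# ∣ S ∣)

  Homogeneous⁺-tl : ∀ {n k p} {x : E (suc n)} → Homogeneous⁺ k p x → Homogeneous⁺ (suc k) p (tl x)
  Homogeneous⁺-tl {k = k} hx S ne = hx (true ∷ S) (λ eq → ne (≡.trans (≡.sym (ℕ.+-suc k ∣ S ∣)) eq))

  Homogeneous⁺-fl : ∀ {n k p} {x : E (suc n)} → Homogeneous⁺ k p x → Homogeneous⁺ k p (fl x)
  Homogeneous⁺-fl hx S = hx (false ∷ S)

  Homogeneous⁺-pred : ∀ {n k p} {x : E n} → Homogeneous⁺ (suc k) (suc p) x → Homogeneous⁺ k p x
  Homogeneous⁺-pred hx S ne = hx S (λ eq → ne (ℕ.suc-injective eq))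

  Homogeneous⁺-∧ : ∀ {n k l p q} {x y : E n} →
                   Homogeneous⁺ k p x → Homogeneous⁺ l q y → Homogeneous⁺ (k + l) (p + q) (x ∧ y)
  Homogeneous⁺-∧ {zero} {k} {l} {p} {q} hx hy [] ne with k + 0 ℕ.≟ p | l + 0 ℕ.≟ q
  ... | no k≢p | _      = trans (*-congʳ (hx [] k≢p)) (zeroˡ _)
  ... | yes _  | no l≢q = trans (*-congˡ (hy [] l≢q)) (zeroʳ _)
  ... | yes k≡p | yes l≡q = ⊥-elim (ne (≡.trans (ℕ.+-identityʳ (k + l))
                              (≡.cong₂ _+_ (≡.trans (≡.sym (ℕ.+-identityʳ k)) k≡p)
                                            (≡.trans (≡.sym (ℕ.+-identityʳ l)) l≡q))))
  Homogeneous⁺-∧ {suc n} {k} {l} {x = x} {y} hx hy (true ∷ U) ne =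
    trans (+-cong (Homogeneous⁺-∧ {k = suc k} (Homogeneous⁺-tl {x = x} hx) (Homogeneous⁺-fl {x = y} hy) U
                     (λ eq → ne (≡.trans (ℕ.+-suc (k + l) ∣ U ∣) eq)))
                  (Homogeneous⁺-∧ {k = k} {l = suc l} (Homogeneous⁺-σ (Homogeneous⁺-fl {x = x} hx))
                                                      (Homogeneous⁺-tl {x = y} hy) U
                     (λ eq → ne (≡.trans (ℕ.+-suc (k + l) ∣ U ∣)
                                         (≡.trans (≡.cong (_+ ∣ U ∣) (≡.sym (ℕ.+-suc k l))) eq)))))
          (+-identityˡ _)
  Homogeneous⁺-∧ {suc n} {x = x} {y} hx hy (false ∷ U) =
    Homogeneous⁺-∧ (Homogeneous⁺-fl {x = x} hx) (Homogeneous⁺-fl {x = y} hy) U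

  𝟙-homogeneous : ∀ {n} → Homogeneous 0 (𝟙 {n})
  𝟙-homogeneous {zero}  [] ne          = ⊥-elim (ne ≡.refl)
  𝟙-homogeneous {suc n} (true ∷ U) ne  = refl
  𝟙-homogeneous {suc n} (false ∷ U) ne = 𝟙-homogeneous {n} U ne

  homogeneous-0⇒scalar : ∀ {n} {x : E n} → Homogeneous 0 x → x ≋ x ⊥ ⊙ 𝟙
  homogeneous-0⇒scalar {zero}  hx []          = sym (*-identityʳ _)
  homogeneous-0⇒scalar {suc n} hx (true ∷ U)  = trans (hx (true ∷ U) (λ ())) (sym (zeroʳ _))
  homogeneous-0⇒scalar {suc n} {x} hx (false ∷ U) =
    homogeneous-0⇒scalar {n} {fl x} (Homogeneous⁺-fl {x = x} hx) U

  gen-linear : ∀ {n} (i : Fin n) → Linear (gen i)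
  gen-linear {suc n} fz     (true ∷ U)  ne = 𝟙-homogeneous {n} U (λ eq → ne (≡.cong suc eq))
  gen-linear {suc n} fz     (false ∷ U) ne = refl
  gen-linear {suc n} (fs i) (true ∷ U)  ne = refl
  gen-linear {suc n} (fs i) (false ∷ U) ne = gen-linear i U ne

  linear-σ : ∀ {n} {v : E n} → Linear v → σ v ≋ neg v
  linear-σ hv S with ∣ S ∣ ℕ.≟ 1
  ... | yes ∣S∣≡1 = signPow-1 ∣S∣≡1
    where
    signPow-1 : ∀ {k r} → k ≡ 1 → signPow k r ≈ - r
    signPow-1 ≡.refl = refl
  ... | no ∣S∣≢1 = trans (signPow-cong ∣ S ∣ (hv S ∣S∣≢1))
                         (trans (signPow-0# ∣ S ∣) (sym (trans (-‿cong (hv S ∣S∣≢1)) -0#≈0#)))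

  linear-tl : ∀ {n} {v : E (suc n)} → Linear v → tl v ≋ tl v ⊥ ⊙ 𝟙
  linear-tl {v = v} hv = homogeneous-0⇒scalar (Homogeneous⁺-pred (Homogeneous⁺-tl {x = v} hv))

  linear-∧-comm : ∀ {n} {v : E n} → Linear v → ∀ z → z ∧ v ≋ v ∧ σ z
  linear-∧-comm {zero}  hv z []          = *-comm _ _
  linear-∧-comm {suc n} {v} hv z (true ∷ U) =
    trans (+-cong (linear-∧-comm (Homogeneous⁺-fl {x = v} hv) (tl z) U) tl-part)
          (trans (+-comm _ _) (+-congˡ (sym fl-part)))
    where
    r = tl v ⊥
    tl-part : (σ (fl z) ∧ tl v) U ≈ (tl v ∧ σ (fl z)) U
    tl-part = trans (∧-congˡ (σ (fl z)) (linear-tl {v = v} hv) U)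
              (trans (∧-⊙-𝟙 r (σ (fl z)) U)
              (trans (sym (⊙-𝟙-∧ r (σ (fl z)) U)) (sym (∧-congʳ (σ (fl z)) (linear-tl {v = v} hv) U))))
    fl-part : (σ (fl v) ∧ neg (σ (tl z))) U ≈ (fl v ∧ σ (tl z)) U
    fl-part = trans (∧-congʳ _ (linear-σ (Homogeneous⁺-fl {x = v} hv)) U)
              (trans (∧-negˡ _ _ U) (trans (-‿cong (∧-negʳ _ _ U)) (-‿involutive _)))
  linear-∧-comm {suc n} {v} hv z (false ∷ U) = linear-∧-comm (Homogeneous⁺-fl {x = v} hv) (fl z) U

  linear-∧-self : ∀ {n} {v : E n} → Linear v → v ∧ v ≋ 𝟘
  linear-∧-self {zero}  hv []          = trans (*-congʳ (hv [] (λ ()))) (zeroˡ _)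
  linear-∧-self {suc n} {v} hv (true ∷ U) =
    trans (+-congˡ (trans (∧-congʳ (tl v) (linear-σ (Homogeneous⁺-fl {x = v} hv)) U) (∧-negˡ _ _ U)))
    (trans (+-congʳ (trans (∧-congʳ (fl v) (linear-tl {v = v} hv) U) (⊙-𝟙-∧ _ (fl v) U)))
    (trans (+-congʳ (sym (trans (∧-congˡ (fl v) (linear-tl {v = v} hv) U) (∧-⊙-𝟙 _ (fl v) U))))
           (-‿inverseʳ _)))
  linear-∧-self {suc n} {v} hv (false ∷ U) = linear-∧-self (Homogeneous⁺-fl {x = v} hv) U

  linear-∧-anticomm : ∀ {n} {v w : E n} → Linear v → Linear w → v ∧ w ≋ neg (w ∧ v)
  linear-∧-anticomm {v = v} {w} hv hw =
    ≋-trans (linear-∧-comm hw v) (≋-trans (∧-congˡ w (linear-σ hv)) (∧-negʳ w v))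

  difference-linear : ∀ {n} (i j : Fin n) → Linear (gen i ⊖ gen j)
  difference-linear i j = Homogeneous⁺-⊕ (gen-linear i) (Homogeneous⁺-neg (gen-linear j))

  ∂-difference : ∀ {n} (i j : Fin n) → ∂ (gen i ⊖ gen j) ≋ 𝟘
  ∂-difference i j =
    ≋-trans (∂-⊕ _ _) (≋-trans (⊕-cong (∂-gen i) (≋-trans (∂-neg _) (neg-cong (∂-gen j)))) (⊕-inverseʳ 𝟙))

  ∂-gen-⊕-difference : ∀ {n} (k i j : Fin n) → ∂ (gen k ⊕ (gen i ⊖ gen j)) ≋ 𝟙
  ∂-gen-⊕-difference k i j = ≋-trans (∂-⊕ _ _) (≋-trans (⊕-cong (∂-gen k) (∂-difference i j)) (⊕-identityʳ 𝟙))

module Substitution {c ℓ} (K : Field c ℓ) where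
  open Field K renaming (_+_ to _+ᴷ_) hiding (_-_)
  open OS K renaming ( _⊕_ to infixl 6 _⊕_ ; _⊖_ to infixl 6 _⊖_ ; _⊙_ to infixr 7 _⊙_
                     ; _∧_ to infixl 8 _∧_ ; _≋_ to infix 4 _≋_ )
  open Exterior K

  -- The algebra map e_i ↦ v i; it is multiplicative when every v i is linear.
  eval : ∀ {n m} → (Fin n → E m) → E n → E m
  eval {zero}  v x = x [] ⊙ 𝟙
  eval {suc n} v x = v fz ∧ eval (v ∘ fs) (tl x) ⊕ eval (v ∘ fs) (fl x)

  AllLinear : ∀ {n m} → (Fin n → E m) → Set ℓ
  AllLinear v = ∀ i → Linear (v i)

  eval-cong : ∀ {n m} (v : Fin n → E m) {x y} → x ≋ y → eval v x ≋ eval v y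
  eval-cong {zero}  v p = ⊙-cong (p []) ≋-refl
  eval-cong {suc n} v p =
    ⊕-cong (∧-congˡ (v fz) (eval-cong (v ∘ fs) (λ S → p (true ∷ S)))) (eval-cong (v ∘ fs) (λ S → p (false ∷ S)))

  eval-congᵛ : ∀ {n m} {v w : Fin n → E m} → (∀ i → v i ≋ w i) → ∀ x → eval v x ≋ eval w x
  eval-congᵛ {zero}  p x = ≋-refl
  eval-congᵛ {suc n} p x = ⊕-cong (∧-cong (p fz) (eval-congᵛ (p ∘ fs) (tl x))) (eval-congᵛ (p ∘ fs) (fl x))

  eval-⊕ : ∀ {n m} (v : Fin n → E m) x y → eval v (x ⊕ y) ≋ eval v x ⊕ eval v y
  eval-⊕ {zero}  v x y = ⊙-distribʳ _ _ 𝟙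
  eval-⊕ {suc n} v x y =
    ≋-trans (⊕-cong (≋-trans (∧-congˡ (v fz) (eval-⊕ (v ∘ fs) (tl x) (tl y))) (∧-distribˡ _ _ _))
                    (eval-⊕ (v ∘ fs) (fl x) (fl y)))
            (⊕-interchange _ _ _ _)

  eval-⊙ : ∀ {n m} (v : Fin n → E m) r x → eval v (r ⊙ x) ≋ r ⊙ eval v x
  eval-⊙ {zero}  v r x = ≋-sym (⊙-⊙ _ _ _)
  eval-⊙ {suc n} v r x =
    ≋-trans (⊕-cong (≋-trans (∧-congˡ (v fz) (eval-⊙ (v ∘ fs) r (tl x))) (∧-⊙ʳ _ _ _)) (eval-⊙ (v ∘ fs) r (fl x)))
            (≋-sym (⊙-distribˡ _ _ _))

  eval-neg : ∀ {n m} (v : Fin n → E m) x → eval v (neg x) ≋ neg (eval v x)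
  eval-neg v x = ≋-trans (eval-cong v (neg≋-1⊙ x)) (≋-trans (eval-⊙ v _ x) (≋-sym (neg≋-1⊙ _)))

  eval-𝟘 : ∀ {n m} (v : Fin n → E m) → eval v 𝟘 ≋ 𝟘
  eval-𝟘 v = ≋-trans (eval-cong v (≋-sym (⊙-zeroˡ 𝟘))) (≋-trans (eval-⊙ v _ 𝟘) (⊙-zeroˡ _))

  eval-𝟙 : ∀ {n m} (v : Fin n → E m) → eval v 𝟙 ≋ 𝟙
  eval-𝟙 {zero}  v = ⊙-identityˡ 𝟙
  eval-𝟙 {suc n} v =
    ≋-trans (⊕-cong (≋-trans (∧-congˡ (v fz) (eval-𝟘 (v ∘ fs))) (∧-zeroʳ _)) (eval-𝟙 (v ∘ fs))) (⊕-identityˡ _)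

  eval-gen : ∀ {n m} (v : Fin n → E m) i → eval v (gen i) ≋ v i
  eval-gen {suc n} v fz     =
    ≋-trans (⊕-cong (≋-trans (∧-congˡ (v fz) (eval-𝟙 (v ∘ fs))) (∧-identityʳ _)) (eval-𝟘 (v ∘ fs))) (⊕-identityʳ _)
  eval-gen {suc n} v (fs i) =
    ≋-trans (⊕-cong (≋-trans (∧-congˡ (v fz) (eval-𝟘 (v ∘ fs))) (∧-zeroʳ _)) (eval-gen (v ∘ fs) i)) (⊕-identityˡ _)

  eval-σ : ∀ {n m} (v : Fin n → E m) → AllLinear v → ∀ x → σ (eval v x) ≋ eval v (σ x)
  eval-σ {zero}  v lin x = ≋-trans (σ-⊙ _ 𝟙) (⊙-congˡ _ σ-𝟙)
  eval-σ {suc n} v lin x =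
    ≋-trans (σ-⊕ _ _)
    (⊕-cong (≋-trans (σ-∧ _ _)
            (≋-trans (∧-cong (linear-σ (lin fz)) (eval-σ (v ∘ fs) (lin ∘ fs) (tl x)))
            (≋-trans (∧-negˡ _ _)
            (≋-trans (≋-sym (∧-negʳ _ _)) (∧-congˡ (v fz) (≋-sym (eval-neg (v ∘ fs) _)))))))
            (eval-σ (v ∘ fs) (lin ∘ fs) (fl x)))

  eval-∧ : ∀ {n m} (v : Fin n → E m) → AllLinear v → ∀ x y → eval v (x ∧ y) ≋ eval v x ∧ eval v y
  eval-∧ {zero}  v lin x y =
    ≋-sym (≋-trans (∧-⊙ˡ _ _ _) (≋-trans (⊙-congˡ _ (∧-identityˡ _)) (⊙-⊙ _ _ _)))
  eval-∧ {suc n} v lin x y = begin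
      v₀ ∧ ev (tl x ∧ fl y ⊕ σ (fl x) ∧ tl y) ⊕ ev (fl x ∧ fl y)
        ≈⟨ ⊕-cong (∧-congˡ v₀ (≋-trans (eval-⊕ (v ∘ fs) _ _)
                   (⊕-cong (IH _ _) (≋-trans (IH _ _) (∧-congʳ c′ (≋-sym (eval-σ (v ∘ fs) (lin ∘ fs) _)))))))
                  (IH _ _) ⟩
      v₀ ∧ (a ∧ d ⊕ σ b ∧ c′) ⊕ b ∧ d
        ≈⟨ ⊕-cong (≋-trans (∧-distribˡ _ _ _) (⊕-cong (≋-sym (∧-assoc _ _ _)) v₀-past-b)) ≋-refl ⟩
      ((v₀ ∧ a) ∧ d ⊕ b ∧ (v₀ ∧ c′)) ⊕ b ∧ d
        ≈⟨ ≋-sym (≋-trans (⊕-cong v₀∧v₀ ≋-refl) (⊕-identityˡ _)) ⟩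
      (v₀ ∧ a) ∧ (v₀ ∧ c′) ⊕ (((v₀ ∧ a) ∧ d ⊕ b ∧ (v₀ ∧ c′)) ⊕ b ∧ d)
        ≈⟨ solve 4 (λ p q r s → (p ⊞ ((q ⊞ r) ⊞ s)) ⊜ ((p ⊞ q) ⊞ (r ⊞ s))) ≋-refl _ _ _ _ ⟩
      ((v₀ ∧ a) ∧ (v₀ ∧ c′) ⊕ (v₀ ∧ a) ∧ d) ⊕ (b ∧ (v₀ ∧ c′) ⊕ b ∧ d)
        ≈⟨ ≋-sym (≋-trans (∧-distribʳ _ _ _) (⊕-cong (∧-distribˡ _ _ _) (∧-distribˡ _ _ _))) ⟩
      (v₀ ∧ a ⊕ b) ∧ (v₀ ∧ c′ ⊕ d) ∎
    where
    open ≋-Reasoning _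
    open ⊕-Solver _ using (solve; _⊜_; _⊞_)
    v₀ = v fz
    ev = eval (v ∘ fs)
    IH = eval-∧ (v ∘ fs) (lin ∘ fs)
    a = ev (tl x) ; b = ev (fl x) ; c′ = ev (tl y) ; d = ev (fl y)
    v₀∧v₀ : (v₀ ∧ a) ∧ (v₀ ∧ c′) ≋ 𝟘
    v₀∧v₀ = begin
      (v₀ ∧ a) ∧ (v₀ ∧ c′)   ≈⟨ ≋-trans (∧-assoc _ _ _) (∧-congˡ v₀ (≋-sym (∧-assoc _ _ _))) ⟩
      v₀ ∧ ((a ∧ v₀) ∧ c′)   ≈⟨ ∧-congˡ v₀ (∧-congʳ c′ (linear-∧-comm (lin fz) a)) ⟩
      v₀ ∧ ((v₀ ∧ σ a) ∧ c′) ≈⟨ ≋-trans (∧-congˡ v₀ (∧-assoc _ _ _)) (≋-sym (∧-assoc _ _ _)) ⟩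
      (v₀ ∧ v₀) ∧ (σ a ∧ c′) ≈⟨ ≋-trans (∧-congʳ _ (linear-∧-self (lin fz))) (∧-zeroˡ _) ⟩
      𝟘                      ∎
    v₀-past-b : v₀ ∧ (σ b ∧ c′) ≋ b ∧ (v₀ ∧ c′)
    v₀-past-b = ≋-trans (≋-sym (∧-assoc _ _ _))
                (≋-trans (∧-congʳ c′ (≋-sym (linear-∧-comm (lin fz) b))) (∧-assoc _ _ _))

  eval-eval : ∀ {n m k} (w : Fin m → E k) → AllLinear w → (v : Fin n → E m) → ∀ x →
              eval w (eval v x) ≋ eval (eval w ∘ v) x
  eval-eval {zero}  w lin v x = ≋-trans (eval-⊙ w _ 𝟙) (⊙-congˡ _ (eval-𝟙 w))
  eval-eval {suc n} w lin v x =
    ≋-trans (eval-⊕ w _ _)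
            (⊕-cong (≋-trans (eval-∧ w lin _ _) (∧-congˡ _ (eval-eval w lin (v ∘ fs) (tl x))))
                    (eval-eval w lin (v ∘ fs) (fl x)))

  -- E n as the subalgebra of E (suc n) not involving e₀.
  wk : ∀ {n} → E n → E (suc n)
  wk x (true ∷ U)  = 0#
  wk x (false ∷ U) = x U

  wk-cong : ∀ {n} {x y : E n} → x ≋ y → wk x ≋ wk y
  wk-cong p (true ∷ U)  = refl
  wk-cong p (false ∷ U) = p U

  wk-⊕ : ∀ {n} (x y : E n) → wk (x ⊕ y) ≋ wk x ⊕ wk y
  wk-⊕ x y (true ∷ U)  = sym (+-identityˡ _)
  wk-⊕ x y (false ∷ U) = refl

  wk-∧ : ∀ {n} (x y : E n) → wk (x ∧ y) ≋ wk x ∧ wk y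
  wk-∧ x y (true ∷ U)  = sym (trans (+-cong (∧-zeroˡ y U) (∧-zeroʳ (σ x) U)) (+-identityˡ _))
  wk-∧ x y (false ∷ U) = refl

  gen-suc : ∀ {n} (i : Fin n) → gen (fs i) ≋ wk (gen i)
  gen-suc i (true ∷ U)  = refl
  gen-suc i (false ∷ U) = refl

  eval-wk : ∀ {n m} (v : Fin n → E m) x → eval (wk ∘ v) x ≋ wk (eval v x)
  eval-wk {zero}  v x (true ∷ U)  = zeroʳ _
  eval-wk {zero}  v x (false ∷ U) = refl
  eval-wk {suc n} v x =
    ≋-trans (⊕-cong (∧-congˡ _ (eval-wk (v ∘ fs) (tl x))) (eval-wk (v ∘ fs) (fl x)))
            (≋-sym (≋-trans (wk-⊕ _ _) (⊕-cong (wk-∧ _ _) ≋-refl)))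

  eval-gen-identity : ∀ {n} (x : E n) → eval gen x ≋ x
  eval-gen-identity {zero}  x [] = *-identityʳ _
  eval-gen-identity {suc n} x =
    ≋-trans (⊕-cong (∧-congˡ (gen fz) (via-wk (tl x))) (via-wk (fl x))) split
    where
    via-wk : ∀ y → eval (gen ∘ fs) y ≋ wk y
    via-wk y = ≋-trans (eval-congᵛ gen-suc y) (≋-trans (eval-wk gen y) (wk-cong (eval-gen-identity y)))
    split : gen fz ∧ wk (tl x) ⊕ wk (fl x) ≋ x
    split (true ∷ U)  = trans (+-identityʳ _)
                        (trans (+-cong (∧-identityˡ (tl x) U) (∧-zeroʳ (σ (fl (gen {suc n} fz))) U)) (+-identityʳ _))
    split (false ∷ U) = trans (+-congʳ (∧-zeroˡ (tl x) U)) (+-identityˡ _)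

  eval-∂ : ∀ {n m} (v : Fin n → E m) → AllLinear v → (∀ i → ∂ (v i) ≋ 𝟙) →
           ∀ x → ∂ (eval v x) ≋ eval v (∂ x)
  eval-∂ {zero}  v lin ∂v x =
    ≋-trans (∂-⊙ _ 𝟙) (≋-trans (⊙-congˡ _ ∂-𝟙) (≋-trans (⊙-zeroʳ _) (≋-sym (⊙-zeroˡ 𝟙))))
  eval-∂ {suc n} v lin ∂v x = begin
      ∂ (v₀ ∧ ev a ⊕ ev b)
        ≈⟨ ≋-trans (∂-⊕ _ _) (⊕-cong (∂-∧ _ _) (IH b)) ⟩
      (∂ v₀ ∧ ev a ⊕ σ v₀ ∧ ∂ (ev a)) ⊕ ev (∂ b)
        ≈⟨ ⊕-cong (⊕-cong (≋-trans (∧-congʳ (ev a) (∂v fz)) (∧-identityˡ _))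
                          (≋-trans (∧-cong (linear-σ (lin fz)) (IH a)) (∧-negˡ _ _))) ≋-refl ⟩
      (ev a ⊕ neg (v₀ ∧ ev (∂ a))) ⊕ ev (∂ b)
        ≈⟨ solve 3 (λ p q r → ((p ⊞ q) ⊞ r) ⊜ (q ⊞ (p ⊞ r))) ≋-refl _ _ _ ⟩
      neg (v₀ ∧ ev (∂ a)) ⊕ (ev a ⊕ ev (∂ b))
        ≈⟨ ≋-sym (⊕-cong (≋-trans (∧-congˡ v₀ (eval-neg (v ∘ fs) _)) (∧-negʳ _ _)) (eval-⊕ (v ∘ fs) _ _)) ⟩
      v₀ ∧ ev (neg (∂ a)) ⊕ ev (a ⊕ ∂ b) ∎
    where
    open ≋-Reasoning _
    open ⊕-Solver _ using (solve; _⊜_; _⊞_)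
    v₀ = v fz
    ev = eval (v ∘ fs)
    IH = eval-∂ (v ∘ fs) (lin ∘ fs) (∂v ∘ fs)
    a = tl x ; b = fl x

  eval-homogeneous : ∀ {n m k p} (v : Fin n → E m) → AllLinear v →
                     ∀ {x} → Homogeneous⁺ k p x → Homogeneous⁺ k p (eval v x)
  eval-homogeneous {zero} {k = k} {p} v lin {x} hx S ne with ∣ S ∣ ℕ.≟ 0
  ... | yes ∣S∣≡0 = trans (*-congʳ (hx [] (≡.subst (λ t → ¬ (k + t ≡ p)) ∣S∣≡0 ne))) (zeroˡ _)
  ... | no ∣S∣≢0  = trans (*-congˡ (𝟙-homogeneous S ∣S∣≢0)) (zeroʳ _)
  eval-homogeneous {suc n} {k = k} {p} v lin {x} hx =
    Homogeneous⁺-⊕ {k = k} {p}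
      (Homogeneous⁺-pred (Homogeneous⁺-∧ {k = 0} {l = suc k} {p = 1} {q = p} (lin fz)
                           (eval-homogeneous (v ∘ fs) (lin ∘ fs) (Homogeneous⁺-tl {x = x} hx))))
      (eval-homogeneous (v ∘ fs) (lin ∘ fs) (Homogeneous⁺-fl {x = x} hx))

  eval-shift : ∀ {n m} (v : Fin n → E m) → AllLinear v → ∀ {t} → Linear t → ∀ x →
               eval (λ i → v i ⊕ t) x ≋ eval v x ⊕ t ∧ eval v (∂ x)
  eval-shift {zero}  v lin {t} lt x =
    ≋-sym (≋-trans (⊕-cong ≋-refl (≋-trans (∧-congˡ t (⊙-zeroˡ 𝟙)) (∧-zeroʳ t))) (⊕-identityʳ _))
  eval-shift {suc n} v lin {t} lt x = begin
      (v₀ ⊕ t) ∧ eval (λ i → v (fs i) ⊕ t) a ⊕ eval (λ i → v (fs i) ⊕ t) b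
        ≈⟨ ⊕-cong (∧-congˡ (v₀ ⊕ t) (IH a)) (IH b) ⟩
      (v₀ ⊕ t) ∧ (ev a ⊕ t ∧ ev (∂ a)) ⊕ (ev b ⊕ t ∧ ev (∂ b))
        ≈⟨ ⊕-cong (≋-trans (∧-distribʳ _ _ _) (⊕-cong (∧-distribˡ _ _ _) (∧-distribˡ _ _ _))) ≋-refl ⟩
      ((v₀ ∧ ev a ⊕ v₀ ∧ (t ∧ ev (∂ a))) ⊕ (t ∧ ev a ⊕ t ∧ (t ∧ ev (∂ a)))) ⊕ (ev b ⊕ t ∧ ev (∂ b))
        ≈⟨ ⊕-cong (⊕-cong (⊕-cong ≋-refl v₀∧t) (≋-trans (⊕-cong ≋-refl t∧t) (⊕-identityʳ _))) ≋-refl ⟩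
      ((v₀ ∧ ev a ⊕ Q) ⊕ t ∧ ev a) ⊕ (ev b ⊕ t ∧ ev (∂ b))
        ≈⟨ solve 5 (λ p q r s u → (((p ⊞ q) ⊞ r) ⊞ (s ⊞ u)) ⊜ ((p ⊞ s) ⊞ (q ⊞ (r ⊞ u)))) ≋-refl _ _ _ _ _ ⟩
      (v₀ ∧ ev a ⊕ ev b) ⊕ (Q ⊕ (t ∧ ev a ⊕ t ∧ ev (∂ b)))
        ≈⟨ ⊕-cong ≋-refl (≋-sym (≋-trans (∧-distribˡ _ _ _) (⊕-cong t∧v₀ (∧-distribˡ _ _ _)))) ⟩
      (v₀ ∧ ev a ⊕ ev b) ⊕ t ∧ (v₀ ∧ neg (ev (∂ a)) ⊕ (ev a ⊕ ev (∂ b)))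
        ≈⟨ ⊕-cong ≋-refl (∧-congˡ t (⊕-cong (∧-congˡ v₀ (≋-sym (eval-neg (v ∘ fs) _)))
                                            (≋-sym (eval-⊕ (v ∘ fs) _ _)))) ⟩
      (v₀ ∧ ev a ⊕ ev b) ⊕ t ∧ (v₀ ∧ ev (neg (∂ a)) ⊕ ev (a ⊕ ∂ b)) ∎
    where
    open ≋-Reasoning _
    open ⊕-Solver _ using (solve; _⊜_; _⊞_)
    v₀ = v fz
    ev = eval (v ∘ fs)
    IH = eval-shift (v ∘ fs) (lin ∘ fs) lt
    a = tl x ; b = fl x
    Q = neg (t ∧ (v₀ ∧ ev (∂ a)))
    v₀∧t : v₀ ∧ (t ∧ ev (∂ a)) ≋ Q
    v₀∧t = ≋-trans (≋-sym (∧-assoc _ _ _))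
           (≋-trans (∧-congʳ _ (linear-∧-anticomm (lin fz) lt)) (≋-trans (∧-negˡ _ _) (neg-cong (∧-assoc _ _ _))))
    t∧t : t ∧ (t ∧ ev (∂ a)) ≋ 𝟘
    t∧t = ≋-trans (≋-sym (∧-assoc _ _ _)) (≋-trans (∧-congʳ _ (linear-∧-self lt)) (∧-zeroˡ _))
    t∧v₀ : t ∧ (v₀ ∧ neg (ev (∂ a))) ≋ Q
    t∧v₀ = ≋-trans (∧-congˡ t (∧-negʳ _ _)) (∧-negʳ _ _)

  eval-translate : ∀ {n m} (v : Fin n → E m) → AllLinear v → (∀ i → ∂ (v i) ≋ 𝟙) →
                   ∀ {t} → Linear t → ∀ x → eval (λ i → v i ⊕ t) x ≋ eval v x ⊕ t ∧ ∂ (eval v x)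
  eval-translate v lin ∂v lt x =
    ≋-trans (eval-shift v lin lt x) (⊕-cong ≋-refl (∧-congˡ _ (≋-sym (eval-∂ v lin ∂v x))))

module Monomials {c ℓ} (K : Field c ℓ) where
  open Field K renaming (_+_ to _+ᴷ_) hiding (_-_)
  open import Algebra.Properties.Ring ring using (-‿involutive; -1*x≈-x)
  open OS K renaming ( _⊕_ to infixl 6 _⊕_ ; _⊖_ to infixl 6 _⊖_ ; _⊙_ to infixr 7 _⊙_
                     ; _∧_ to infixl 8 _∧_ ; _≋_ to infix 4 _≋_ )
  open Exterior K
  open Substitution K

  Sign : Carrier → Set ℓ
  Sign u = (u ≈ 1#) ⊎ (u ≈ - 1#)

  -1*-1≈1 : - 1# * - 1# ≈ 1#
  -1*-1≈1 = trans (-1*x≈-x _) (-‿involutive _)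

  Sign-* : ∀ {u v} → Sign u → Sign v → Sign (u * v)
  Sign-* (inj₁ u≈1)  (inj₁ v≈1)  = inj₁ (trans (*-cong u≈1 v≈1) (*-identityˡ _))
  Sign-* (inj₁ u≈1)  (inj₂ v≈-1) = inj₂ (trans (*-cong u≈1 v≈-1) (*-identityˡ _))
  Sign-* (inj₂ u≈-1) (inj₁ v≈1)  = inj₂ (trans (*-cong u≈-1 v≈1) (*-identityʳ _))
  Sign-* (inj₂ u≈-1) (inj₂ v≈-1) = inj₁ (trans (*-cong u≈-1 v≈-1) -1*-1≈1)

  Sign⇒square≈1 : ∀ {u} → Sign u → u * u ≈ 1#
  Sign⇒square≈1 (inj₁ u≈1)  = trans (*-cong u≈1 u≈1) (*-identityˡ _)
  Sign⇒square≈1 (inj₂ u≈-1) = trans (*-cong u≈-1 u≈-1) -1*-1≈1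

  Sign-signPow : ∀ k → Sign (signPow k 1#)
  Sign-signPow zero = inj₁ refl
  Sign-signPow (suc k) with Sign-signPow k
  ... | inj₁ ≈1  = inj₂ (-‿cong ≈1)
  ... | inj₂ ≈-1 = inj₁ (trans (-‿cong ≈-1) (-‿involutive _))

  infix 4 _≋±_
  _≋±_ : ∀ {n} → E n → E n → Set (c ⊔ ℓ)
  x ≋± y = ∃ λ u → Sign u × x ≋ u ⊙ y

  ≋⇒≋± : ∀ {n} {x y : E n} → x ≋ y → x ≋± y
  ≋⇒≋± {y = y} x≋y = 1# , inj₁ refl , ≋-trans x≋y (≋-sym (⊙-identityˡ y))

  ≋±-sym : ∀ {n} {x y : E n} → x ≋± y → y ≋± x
  ≋±-sym (u , su , x≋uy) = u , su ,
    ≋-sym (≋-trans (⊙-congˡ u x≋uy)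
          (≋-trans (⊙-⊙ u u _) (≋-trans (⊙-cong (Sign⇒square≈1 su) ≋-refl) (⊙-identityˡ _))))

  ≋±-trans : ∀ {n} {x y z : E n} → x ≋± y → y ≋± z → x ≋± z
  ≋±-trans (u , su , x≋uy) (u′ , su′ , y≋u′z) =
    u * u′ , Sign-* su su′ , ≋-trans x≋uy (≋-trans (⊙-congˡ u y≋u′z) (⊙-⊙ u u′ _))

  ≋±-∧ : ∀ {n} {x x′ y y′ : E n} → x ≋± x′ → y ≋± y′ → x ∧ y ≋± x′ ∧ y′
  ≋±-∧ (u , su , x≋) (u′ , su′ , y≋) = u * u′ , Sign-* su su′ ,
    ≋-trans (∧-cong x≋ y≋) (≋-trans (∧-⊙ˡ u _ _) (≋-trans (⊙-congˡ u (∧-⊙ʳ u′ _ _)) (⊙-⊙ u u′ _)))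

  eval-≋± : ∀ {n m} (v : Fin n → E m) {x y} → x ≋± y → eval v x ≋± eval v y
  eval-≋± v (u , su , x≋) = u , su , ≋-trans (eval-cong v x≋) (eval-⊙ v u _)

  σ-basis : ∀ {n} (T : Subset n) → σ (basis T) ≋ signPow ∣ T ∣ 1# ⊙ basis T
  σ-basis T S with ≡-dec _≟ᵇ_ S T
  ... | yes ≡.refl = sym (*-identityʳ _)
  ... | no _       = trans (signPow-0# ∣ S ∣) (sym (zeroʳ _))

  basis-≡ : ∀ {n} {A B : Subset n} → A ≡ B → basis A ≋ basis B
  basis-≡ ≡.refl = ≋-refl

  basis-∧ : ∀ {n} {A B : Subset n} → Disjoint A B → basis A ∧ basis B ≋± basis (A ∪ B)
  basis-∧ {zero} {[]} {[]} _ = ≋⇒≋± (λ { [] → *-identityˡ _ })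
  basis-∧ {suc n} {true ∷ A} {true ∷ B} d = ⊥-elim (d here here)
  basis-∧ {suc n} {true ∷ A} {false ∷ B} d with basis-∧ (Disjoint-tail d)
  ... | u , su , eq = u , su , λ
    { (true ∷ U)  → trans (+-congˡ (∧-zeroʳ (σ {n} 𝟘) U)) (trans (+-identityʳ _) (eq U))
    ; (false ∷ U) → trans (∧-zeroˡ (basis B) U) (sym (zeroʳ u)) }
  basis-∧ {suc n} {false ∷ A} {true ∷ B} d with basis-∧ (Disjoint-tail d)
  ... | u , su , eq = signPow ∣ A ∣ 1# * u , Sign-* (Sign-signPow ∣ A ∣) su , λ
    { (true ∷ U)  → trans (+-cong (∧-zeroˡ {n} 𝟘 U)
                                  (trans (∧-congʳ (basis B) (σ-basis A) U) (∧-⊙ˡ _ (basis A) (basis B) U)))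
                          (trans (+-identityˡ _) (trans (*-congˡ (eq U)) (sym (*-assoc _ _ _))))
    ; (false ∷ U) → trans (∧-zeroʳ (basis A) U) (sym (zeroʳ _)) }
  basis-∧ {suc n} {false ∷ A} {false ∷ B} d with basis-∧ (Disjoint-tail d)
  ... | u , su , eq = u , su , λ
    { (true ∷ U)  → trans (+-cong (∧-zeroˡ (basis B) U) (∧-zeroʳ (σ (basis A)) U))
                          (trans (+-identityˡ _) (sym (zeroʳ u)))
    ; (false ∷ U) → eq U }

  gen-∧-basis : ∀ {n} {i : Fin n} {S} → i ∈ S → gen i ∧ basis S ≋ 𝟘
  gen-∧-basis {i = i} {S} i∈S with ≋±-sym (basis-∧ (Disjoint-sym (Disjoint--⁅⁆ S i)))
  ... | u , _ , eq = begin
    gen i ∧ basis S                          ≈⟨ ∧-congˡ (gen i) (basis-≡ (≡.sym S≡)) ⟩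
    gen i ∧ basis (⁅ i ⁆ ∪ (S - i))          ≈⟨ ∧-congˡ (gen i) eq ⟩
    gen i ∧ (u ⊙ (gen i ∧ basis (S - i)))    ≈⟨ ≋-trans (∧-⊙ʳ u _ _) (⊙-congˡ u (≋-sym (∧-assoc _ _ _))) ⟩
    u ⊙ ((gen i ∧ gen i) ∧ basis (S - i))    ≈⟨ ⊙-congˡ u (≋-trans (∧-congʳ _ (linear-∧-self (gen-linear i))) (∧-zeroˡ _)) ⟩
    u ⊙ 𝟘                                    ≈⟨ ⊙-zeroʳ u ⟩
    𝟘                                        ∎
    where
    open ≋-Reasoning _
    S≡ : ⁅ i ⁆ ∪ (S - i) ≡ S
    S≡ = ≡.trans (∪-comm ⁅ i ⁆ (S - i)) (∈⇒-∪⁅⁆≡ i∈S)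

  eval-basis-∪ : ∀ {n m} (v : Fin n → E m) → AllLinear v → ∀ {A B} → Disjoint A B →
                 eval v (basis (A ∪ B)) ≋± eval v (basis A) ∧ eval v (basis B)
  eval-basis-∪ v lin d = ≋±-trans (eval-≋± v (≋±-sym (basis-∧ d))) (≋⇒≋± (eval-∧ v lin _ _))

  eval-rename-basis : ∀ {k m} {φ : Fin k → Fin m} → Injective _≡_ _≡_ φ → ∀ A →
                      eval (gen ∘ φ) (basis A) ≋± basis (image φ A)
  eval-rename-basis φ-inj [] = ≋⇒≋± (⊙-identityˡ 𝟙)
  eval-rename-basis {φ = φ} φ-inj (true ∷ A) =
    ≋±-trans (≋⇒≋± (≋-trans (⊕-congˡ _ (eval-𝟘 (gen ∘ φ ∘ fs))) (⊕-identityʳ _)))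
             (≋±-trans (≋±-∧ (≋⇒≋± ≋-refl) (eval-rename-basis (fs-injective ∘ φ-inj) A)) (basis-∧ φ₀∉))
    where
    φ₀∉ : Disjoint ⁅ φ fz ⁆ (image (φ ∘ fs) A)
    φ₀∉ j∈⁅φ₀⁆ j∈ with ∈-image⁻ (φ ∘ fs) A j∈
    ... | x , _ , eq with φ-inj (≡.trans eq (x∈⁅y⁆⇒x≡y (φ fz) j∈⁅φ₀⁆))
    ... | ()
  eval-rename-basis {φ = φ} φ-inj (false ∷ A) =
    ≋±-trans (≋⇒≋± (≋-trans (⊕-congʳ _ (≋-trans (∧-congˡ _ (eval-𝟘 (gen ∘ φ ∘ fs))) (∧-zeroʳ _)))
                            (⊕-identityˡ _)))
             (eval-rename-basis (fs-injective ∘ φ-inj) A)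

  eval-basis-image : ∀ {k m p} {φ : Fin k → Fin m} → Injective _≡_ _≡_ φ →
                     (v : Fin m → E p) → AllLinear v → ∀ A → eval v (basis (image φ A)) ≋± eval (v ∘ φ) (basis A)
  eval-basis-image {φ = φ} φ-inj v lin A =
    ≋±-trans (eval-≋± v (≋±-sym (eval-rename-basis φ-inj A)))
             (≋⇒≋± (≋-trans (eval-eval v lin (gen ∘ φ) (basis A)) (eval-congᵛ (eval-gen v ∘ φ) (basis A))))

module OSIdeal {c ℓ} (K : Field c ℓ) where
  open Field K renaming (_+_ to _+ᴷ_) hiding (_-_)
  open OS K renaming ( _⊕_ to infixl 6 _⊕_ ; _⊖_ to infixl 6 _⊖_ ; _⊙_ to infixr 7 _⊙_
                     ; _∧_ to infixl 8 _∧_ ; _≋_ to infix 4 _≋_ )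
  open Exterior K
  open Substitution K
  open Monomials K

  module _ {n} (D : Subset n → Set) where

    InIdeal-𝟘 : ∀ {x} → x ≋ 𝟘 → InIdeal D x
    InIdeal-𝟘 p = resp (≋-sym p) gen0

    InIdeal-∧ˡ : ∀ x {y} → InIdeal D y → InIdeal D (x ∧ y)
    InIdeal-∧ˡ x gen0           = InIdeal-𝟘 (∧-zeroʳ x)
    InIdeal-∧ˡ x (genS a b S d) = resp (≋-trans (∧-congʳ b (∧-assoc _ _ _)) (∧-assoc _ _ _)) (genS (x ∧ a) b S d)
    InIdeal-∧ˡ x (add p q)      = resp (≋-sym (∧-distribˡ _ _ _)) (add (InIdeal-∧ˡ x p) (InIdeal-∧ˡ x q))
    InIdeal-∧ˡ x (resp e p)     = resp (∧-congˡ x e) (InIdeal-∧ˡ x p)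

    InIdeal-∧ʳ : ∀ x {y} → InIdeal D y → InIdeal D (y ∧ x)
    InIdeal-∧ʳ x gen0           = InIdeal-𝟘 (∧-zeroˡ x)
    InIdeal-∧ʳ x (genS a b S d) = resp (≋-sym (∧-assoc _ _ _)) (genS a (b ∧ x) S d)
    InIdeal-∧ʳ x (add p q)      = resp (≋-sym (∧-distribʳ _ _ _)) (add (InIdeal-∧ʳ x p) (InIdeal-∧ʳ x q))
    InIdeal-∧ʳ x (resp e p)     = resp (∧-congʳ x e) (InIdeal-∧ʳ x p)

    InIdeal-⊙ : ∀ r {y} → InIdeal D y → InIdeal D (r ⊙ y)
    InIdeal-⊙ r p = resp (⊙-𝟙-∧ r _) (InIdeal-∧ˡ (r ⊙ 𝟙) p)

    InIdeal-∂ : ∀ {y} → InIdeal D y → InIdeal D (∂ y)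
    InIdeal-∂ gen0           = InIdeal-𝟘 ∂-𝟘
    InIdeal-∂ (genS x y S d) =
      resp (≋-sym leibniz) (add (genS (∂ x) y S d) (genS (- signPow ∣ S ∣ 1# ⊙ σ x) (∂ y) S d))
      where
      e = basis S
      σ∂e : σ (∂ e) ≋ (- signPow ∣ S ∣ 1#) ⊙ ∂ e
      σ∂e = ≋-trans (≋-sym (neg-involutive _))
            (≋-trans (neg-cong (≋-sym (∂-σ e)))
            (≋-trans (neg-cong (≋-trans (∂-cong (σ-basis S)) (∂-⊙ _ e))) (≋-sym (neg-⊙ _ _))))
      leibniz : ∂ (x ∧ ∂ e ∧ y) ≋ ∂ x ∧ ∂ e ∧ y ⊕ (- signPow ∣ S ∣ 1# ⊙ σ x) ∧ ∂ e ∧ ∂ y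
      leibniz = ≋-trans (∂-∧ _ _)
                (⊕-cong (∧-congʳ y (≋-trans (∂-∧ _ _)
                          (≋-trans (⊕-cong ≋-refl (≋-trans (∧-congˡ _ (∂-∂ e)) (∧-zeroʳ _))) (⊕-identityʳ _))))
                        (∧-congʳ (∂ y) (≋-trans (σ-∧ _ _)
                          (≋-trans (∧-congˡ _ σ∂e) (≋-trans (∧-⊙ʳ _ _ _) (≋-sym (∧-⊙ˡ _ _ _)))))))
    InIdeal-∂ (add p q)  = resp (≋-sym (∂-⊕ _ _)) (add (InIdeal-∂ p) (InIdeal-∂ q))
    InIdeal-∂ (resp e p) = resp (∂-cong e) (InIdeal-∂ p)

    -- e_S = e_i ∧ ∂ e_S for i ∈ S, by Leibniz applied to e_i ∧ e_S = 0.
    InIdeal-basis : ∀ {S} → D S → ∀ {i} → i ∈ S → InIdeal D (basis S)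
    InIdeal-basis {S} d {i} i∈S = resp (≋-trans (∧-identityʳ _) (≋-sym e≋)) (genS (gen i) 𝟙 S d)
      where
      e≋ : basis S ≋ gen i ∧ ∂ (basis S)
      e≋ = ⊖≋𝟘⇒≋ (≋-sym (begin
        𝟘                                        ≈⟨ ≋-sym (≋-trans (∂-cong (gen-∧-basis i∈S)) ∂-𝟘) ⟩
        ∂ (gen i ∧ basis S)                      ≈⟨ ∂-∧ _ _ ⟩
        ∂ (gen i) ∧ basis S ⊕ σ (gen i) ∧ ∂ (basis S)
          ≈⟨ ⊕-cong (≋-trans (∧-congʳ _ (∂-gen i)) (∧-identityˡ _))
                    (≋-trans (∧-congʳ _ (linear-σ (gen-linear i))) (∧-negˡ _ _)) ⟩
        basis S ⊕ neg (gen i ∧ ∂ (basis S))      ∎))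
        where open ≋-Reasoning n

    InIdeal-translate : ∀ {m} (w : Fin m → E n) → AllLinear w → (∀ i → ∂ (w i) ≋ 𝟙) →
                        ∀ {t} → Linear t → ∀ x → InIdeal D (eval w x) → InIdeal D (eval (λ i → w i ⊕ t) x)
    InIdeal-translate w lin ∂w {t} lt x p =
      resp (≋-sym (eval-translate w lin ∂w lt x)) (add p (InIdeal-∧ˡ t (InIdeal-∂ p)))

    -- X ∧ (Y + (e₀ − e₁) ∧ ∂Y) = (X ∧ e₀) ∧ ∂Y + X ∧ ∂(e₁ ∧ Y), because ∂ e₁ = 1.
    InIdeal-glue : ∀ {X Y e₀ e₁ : E n} → Linear e₁ → ∂ e₁ ≋ 𝟙 →
                   InIdeal D (X ∧ e₀) → InIdeal D (e₁ ∧ Y) → InIdeal D (X ∧ (Y ⊕ (e₀ ⊖ e₁) ∧ ∂ Y))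
    InIdeal-glue {X} {Y} {e₀} {e₁} lin ∂e₁ p q =
      resp (≋-sym glue) (add (InIdeal-∧ʳ (∂ Y) p) (InIdeal-∧ˡ X (InIdeal-∂ q)))
      where
      open ≋-Reasoning n
      open ⊕-Solver n using (solve; _⊜_; _⊞_)
      glue : X ∧ (Y ⊕ (e₀ ⊖ e₁) ∧ ∂ Y) ≋ X ∧ e₀ ∧ ∂ Y ⊕ X ∧ ∂ (e₁ ∧ Y)
      glue = begin
        X ∧ (Y ⊕ (e₀ ⊖ e₁) ∧ ∂ Y)
          ≈⟨ ≋-trans (∧-distribˡ _ _ _) (⊕-cong ≋-refl (≋-trans (∧-congˡ X (∧-distribʳ _ _ _)) (∧-distribˡ _ _ _))) ⟩
        X ∧ Y ⊕ (X ∧ (e₀ ∧ ∂ Y) ⊕ X ∧ (neg e₁ ∧ ∂ Y))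
          ≈⟨ ⊕-cong ≋-refl (⊕-cong (≋-sym (∧-assoc _ _ _)) (≋-trans (∧-congˡ X (∧-negˡ _ _)) (∧-negʳ _ _))) ⟩
        X ∧ Y ⊕ (X ∧ e₀ ∧ ∂ Y ⊕ neg (X ∧ (e₁ ∧ ∂ Y)))
          ≈⟨ solve 3 (λ p q r → (p ⊞ (q ⊞ r)) ⊜ (q ⊞ (p ⊞ r))) ≋-refl _ _ _ ⟩
        X ∧ e₀ ∧ ∂ Y ⊕ (X ∧ Y ⊕ neg (X ∧ (e₁ ∧ ∂ Y)))
          ≈⟨ ⊕-cong ≋-refl (≋-sym (≋-trans (∧-distribˡ _ _ _) (⊕-cong ≋-refl (∧-negʳ _ _)))) ⟩
        X ∧ e₀ ∧ ∂ Y ⊕ X ∧ (Y ⊕ neg (e₁ ∧ ∂ Y))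
          ≈⟨ ⊕-cong ≋-refl (∧-congˡ X (≋-sym (≋-trans (∂-∧ _ _)
               (⊕-cong (≋-trans (∧-congʳ Y ∂e₁) (∧-identityˡ Y))
                       (≋-trans (∧-congʳ _ (linear-σ lin)) (∧-negˡ _ _)))))) ⟩
        X ∧ e₀ ∧ ∂ Y ⊕ X ∧ ∂ (e₁ ∧ Y) ∎

  eval-preserves-ideal : ∀ {n m} {D : Subset n → Set} {D′ : Subset m → Set} (v : Fin n → E m) →
                         AllLinear v → (∀ i → ∂ (v i) ≋ 𝟙) → (∀ S → D S → InIdeal D′ (eval v (basis S))) →
                         ∀ {y} → InIdeal D y → InIdeal D′ (eval v y)
  eval-preserves-ideal {D′ = D′} v lin ∂v gens = go
    where
    go : ∀ {y} → InIdeal _ y → InIdeal D′ (eval v y)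
    go gen0             = InIdeal-𝟘 D′ (eval-𝟘 v)
    go (genS x y S d)   =
      resp (≋-sym (≋-trans (eval-∧ v lin _ _) (∧-congʳ _ (≋-trans (eval-∧ v lin _ _)
                                                          (∧-congˡ _ (≋-sym (eval-∂ v lin ∂v _)))))))
           (InIdeal-∧ʳ D′ (eval v y) (InIdeal-∧ˡ D′ (eval v x) (InIdeal-∂ D′ (gens S d))))
    go (add p q)        = resp (≋-sym (eval-⊕ v _ _)) (add (go p) (go q))
    go (resp e p)       = resp (eval-cong v e) (go p)

  module _ {m} (D : Subset m → Set) where

    InIdeal-≋± : ∀ {x y} → x ≋± y → InIdeal D y → InIdeal D x
    InIdeal-≋± (u , _ , x≋uy) p = resp (≋-sym x≋uy) (InIdeal-⊙ D u p)

    InIdeal-eval-rename : ∀ {k} {φ : Fin k → Fin m} → Injective _≡_ _≡_ φ →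
                          ∀ {A i} → i ∈ A → D (image φ A) → InIdeal D (eval (gen ∘ φ) (basis A))
    InIdeal-eval-rename φ-inj {A} i∈A d =
      InIdeal-≋± (eval-rename-basis φ-inj A) (InIdeal-basis D d (∈-image⁺ _ i∈A))

    InIdeal-eval-image : ∀ {k n} {φ : Fin k → Fin n} → Injective _≡_ _≡_ φ → (v : Fin n → E m) → AllLinear v →
                         ∀ {A} → InIdeal D (eval (v ∘ φ) (basis A)) → InIdeal D (eval v (basis (image φ A)))
    InIdeal-eval-image φ-inj v lin {A} = InIdeal-≋± (eval-basis-image φ-inj v lin A)

    InIdeal-eval-∪ : ∀ {n} (v : Fin n → E m) → AllLinear v → ∀ {A B} → Disjoint A B →
                     InIdeal D (eval v (basis A)) ⊎ InIdeal D (eval v (basis B)) →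
                     InIdeal D (eval v (basis (A ∪ B)))
    InIdeal-eval-∪ v lin d (inj₁ p) = InIdeal-≋± (eval-basis-∪ v lin d) (InIdeal-∧ʳ D _ p)
    InIdeal-eval-∪ v lin d (inj₂ q) = InIdeal-≋± (eval-basis-∪ v lin d) (InIdeal-∧ˡ D _ q)

    InIdeal-eval-∷ : ∀ {n} (v : Fin (suc n) → E m) {x S} →
                     InIdeal D (eval (v ∘ fs) (basis S)) → InIdeal D (eval v (basis (x ∷ S)))
    InIdeal-eval-∷ v {true}  p = add (InIdeal-∧ˡ D (v fz) p) (InIdeal-𝟘 D (eval-𝟘 (v ∘ fs)))
    InIdeal-eval-∷ v {false} p = add (InIdeal-∧ˡ D (v fz) (InIdeal-𝟘 D (eval-𝟘 (v ∘ fs)))) p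

    InIdeal-eval-delete : ∀ {n} (w : Fin n → E m) → AllLinear w → ∀ {C p} → p ∈ C → InIdeal D (eval w (basis C)) →
                          InIdeal D (eval w (basis (C - p)) ∧ w p) × InIdeal D (w p ∧ eval w (basis (C - p)))
    InIdeal-eval-delete w lin {C} {p} p∈C q =
        InIdeal-≋± (≋±-trans (≋⇒≋± (∧-congˡ _ (≋-sym (eval-gen w p))))
                   (≋±-trans (≋±-sym (eval-basis-∪ w lin (Disjoint--⁅⁆ C p)))
                             (≋⇒≋± (eval-cong w (basis-≡ (∈⇒-∪⁅⁆≡ p∈C)))))) q
      , InIdeal-≋± (≋±-trans (≋⇒≋± (∧-congʳ _ (≋-sym (eval-gen w p))))
                   (≋±-trans (≋±-sym (eval-basis-∪ w lin (Disjoint-sym (Disjoint--⁅⁆ C p))))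
                             (≋⇒≋± (eval-cong w (basis-≡ (≡.trans (∪-comm ⁅ p ⁆ (C - p)) (∈⇒-∪⁅⁆≡ p∈C))))))) q

    ≋⇒Cong : ∀ {x y} → x ≋ y → Cong D x y
    ≋⇒Cong {x} {y} x≋y = InIdeal-𝟘 D (λ S → trans (+-congʳ (x≋y S)) (-‿inverseʳ (y S)))

  eval-gradedAlgIso : ∀ {n m} {D : Subset n → Set} {D′ : Subset m → Set}
                      (v : Fin n → E m) → AllLinear v → (∀ i → ∂ (v i) ≋ 𝟙) →
                      (w : Fin m → E n) → AllLinear w → (∀ j → ∂ (w j) ≋ 𝟙) →
                      (∀ i → eval w (v i) ≋ gen i) → (∀ j → eval v (w j) ≋ gen j) →
                      (∀ S → D S → InIdeal D′ (eval v (basis S))) →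
                      (∀ S → D′ S → InIdeal D (eval w (basis S))) →
                      GradedAlgIso D D′
  eval-gradedAlgIso {D = D} {D′} v lin-v ∂v w lin-w ∂w wv vw v-ideal w-ideal = record
    { f      = eval v
    ; g      = eval w
    ; f-resp = λ {x} {y} p → resp (eval-⊖ v x y) (eval-preserves-ideal v lin-v ∂v v-ideal p)
    ; f-+    = λ x y → ≋⇒Cong D′ (eval-⊕ v x y)
    ; f-⊙    = λ r x → ≋⇒Cong D′ (eval-⊙ v r x)
    ; f-∧    = λ x y → ≋⇒Cong D′ (eval-∧ v lin-v x y)
    ; f-𝟙    = ≋⇒Cong D′ (eval-𝟙 v)
    ; f-deg  = λ p x hx → eval v x , eval-homogeneous v lin-v hx , ≋⇒Cong D′ ≋-refl
    ; g-resp = λ {x} {y} p → resp (eval-⊖ w x y) (eval-preserves-ideal w lin-w ∂w w-ideal p)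
    ; g-+    = λ x y → ≋⇒Cong D (eval-⊕ w x y)
    ; g-⊙    = λ r x → ≋⇒Cong D (eval-⊙ w r x)
    ; g-∧    = λ x y → ≋⇒Cong D (eval-∧ w lin-w x y)
    ; g-𝟙    = ≋⇒Cong D (eval-𝟙 w)
    ; g-deg  = λ p x hx → eval w x , eval-homogeneous w lin-w hx , ≋⇒Cong D ≋-refl
    ; gf     = λ x → ≋⇒Cong D (eval-inverse w lin-w v wv x)
    ; fg     = λ y → ≋⇒Cong D′ (eval-inverse v lin-v w vw y)
    }
    where
    eval-⊖ : ∀ {k l} (u : Fin k → E l) x y → eval u (x ⊖ y) ≋ eval u x ⊖ eval u y
    eval-⊖ u x y = ≋-trans (eval-⊕ u x (neg y)) (⊕-congˡ _ (eval-neg u y))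
    eval-inverse : ∀ {k l} (u : Fin k → E l) → AllLinear u → (u′ : Fin l → E k) →
                   (∀ j → eval u (u′ j) ≋ gen j) → ∀ x → eval u (eval u′ x) ≋ x
    eval-inverse u lin u′ inv x =
      ≋-trans (eval-eval u lin u′ x) (≋-trans (eval-congᵛ inv x) (eval-gen-identity x))

module ParallelConnection {c ℓ} (K : Field c ℓ) {a b : ℕ} (G₀ : Matroid (suc a)) (G₁ : Matroid (suc b))
                          (p₀ : Fin (suc a)) (p₁ : Fin (suc b)) where
  open OS K renaming ( _⊕_ to infixl 6 _⊕_ ; _⊖_ to infixl 6 _⊖_ ; _⊙_ to infixr 7 _⊙_
                     ; _∧_ to infixl 8 _∧_ ; _≋_ to infix 4 _≋_ )
  open Exterior K
  open Substitution K
  open Monomials K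
  open OSIdeal K
  open Parallel G₀ G₁ p₀ p₁

  DG : Subset (suc a + suc b) → Set
  DG = DepDirectSum G₀ G₁

  DP : Subset (suc (suc a + b)) → Set
  DP = DepSum DepIsthmus (DepParallel G₀ G₁ p₀ p₁)

  ψ₀ : Fin (suc a) → Fin (suc a + suc b)
  ψ₀ = _↑ˡ suc b

  ψ₁ : Fin (suc b) → Fin (suc a + suc b)
  ψ₁ = suc a ↑ʳ_

  φ₀ : Fin (suc a) → Fin (suc (suc a + b))
  φ₀ = fs ∘ ι₀

  φ₁ : Fin (suc b) → Fin (suc (suc a + b))
  φ₁ = fs ∘ ι₁

  ι₁-p₁ : ι₁ p₁ ≡ ι₀ p₀
  ι₁-p₁ with p₁ ≟ᶠ p₁
  ... | yes _ = ≡.refl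
  ... | no p₁≢p₁ = ⊥-elim (p₁≢p₁ ≡.refl)

  ι₁-punchIn : ∀ j → ι₁ (punchIn p₁ j) ≡ suc a ↑ʳ j
  ι₁-punchIn j with p₁ ≟ᶠ punchIn p₁ j
  ... | yes p₁≡ = ⊥-elim (punchInᵢ≢i p₁ j (≡.sym p₁≡))
  ... | no p₁≢  = ≡.cong (suc a ↑ʳ_) (≡.trans (punchOut-cong p₁ ≡.refl) (punchOut-punchIn p₁))

  p₁-or-punchIn : ∀ w → w ≡ p₁ ⊎ ∃ λ j → punchIn p₁ j ≡ w
  p₁-or-punchIn w with w ≟ᶠ p₁
  ... | yes w≡p₁ = inj₁ w≡p₁
  ... | no w≢p₁  = inj₂ (punchOut (w≢p₁ ∘ ≡.sym) , punchIn-punchOut _)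

  ι₀-injective : Injective _≡_ _≡_ ι₀
  ι₀-injective = ↑ˡ-injective b _ _

  ι₁-injective : Injective _≡_ _≡_ ι₁
  ι₁-injective {w} {w′} eq with p₁ ≟ᶠ w | p₁ ≟ᶠ w′
  ... | yes p₁≡w  | yes p₁≡w′ = ≡.trans (≡.sym p₁≡w) p₁≡w′
  ... | yes _     | no _      = ⊥-elim (↑ˡ≢↑ʳ p₀ _ eq)
  ... | no _      | yes _     = ⊥-elim (↑ˡ≢↑ʳ p₀ _ (≡.sym eq))
  ... | no p₁≢w   | no p₁≢w′  = punchOut-injective p₁≢w p₁≢w′ (↑ʳ-injective (suc a) _ _ eq)

  ψ₀-injective : Injective _≡_ _≡_ ψ₀
  ψ₀-injective = ↑ˡ-injective (suc b) _ _

  ψ₁-injective : Injective _≡_ _≡_ ψ₁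
  ψ₁-injective = ↑ʳ-injective (suc a) _ _

  φ₀-injective : Injective _≡_ _≡_ φ₀
  φ₀-injective = ι₀-injective ∘ fs-injective

  φ₁-injective : Injective _≡_ _≡_ φ₁
  φ₁-injective = ι₁-injective ∘ fs-injective

  -- In {0} ⊕ P the isthmus is fz and the common point is φ₀ p₀ = φ₁ p₁.

  s : E (suc (suc a + b))
  s = gen fz ⊖ gen (φ₀ p₀)

  s′ : E (suc a + suc b)
  s′ = gen (ψ₀ p₀) ⊖ gen (ψ₁ p₁)

  s-linear : Linear s
  s-linear = difference-linear fz (φ₀ p₀)

  s′-linear : Linear s′
  s′-linear = difference-linear (ψ₀ p₀) (ψ₁ p₁)

  forward : Fin (suc a + suc b) → E (suc (suc a + b))
  forward = [ gen ∘ φ₀ , (λ w → gen (φ₁ w) ⊕ s) ]′ ∘ splitAt (suc a)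

  backwardP : Fin (suc a + b) → E (suc a + suc b)
  backwardP = [ gen ∘ ψ₀ , (λ j → gen (ψ₁ (punchIn p₁ j)) ⊕ s′) ]′ ∘ splitAt (suc a)

  backward : Fin (suc (suc a + b)) → E (suc a + suc b)
  backward fz     = gen (ψ₁ p₁)
  backward (fs k) = backwardP k

  forward-ψ₀ : ∀ x → forward (ψ₀ x) ≋ gen (φ₀ x)
  forward-ψ₀ x rewrite splitAt-↑ˡ (suc a) x (suc b) = ≋-refl

  forward-ψ₁ : ∀ w → forward (ψ₁ w) ≋ gen (φ₁ w) ⊕ s
  forward-ψ₁ w rewrite splitAt-↑ʳ (suc a) (suc b) w = ≋-refl

  backwardP-ι₀ : ∀ x → backwardP (ι₀ x) ≋ gen (ψ₀ x)
  backwardP-ι₀ x rewrite splitAt-↑ˡ (suc a) x b = ≋-refl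

  backwardP-↑ʳ : ∀ j → backwardP (suc a ↑ʳ j) ≋ gen (ψ₁ (punchIn p₁ j)) ⊕ s′
  backwardP-↑ʳ j rewrite splitAt-↑ʳ (suc a) b j = ≋-refl

  backwardP-ι₁ : ∀ w → backwardP (ι₁ w) ≋ gen (ψ₁ w) ⊕ s′
  backwardP-ι₁ w with p₁-or-punchIn w
  ... | inj₁ ≡.refl rewrite ι₁-p₁ =
    ≋-trans (backwardP-ι₀ p₀) (≋-sym (x⊕[y⊖x]≋y (gen (ψ₁ p₁)) (gen (ψ₀ p₀))))
  ... | inj₂ (j , ≡.refl) rewrite ι₁-punchIn j = backwardP-↑ʳ j

  forward-linear : AllLinear forward
  forward-linear i with splitAt (suc a) i
  ... | inj₁ x = gen-linear (φ₀ x)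
  ... | inj₂ w = Homogeneous⁺-⊕ (gen-linear (φ₁ w)) s-linear

  ∂-forward : ∀ i → ∂ (forward i) ≋ 𝟙
  ∂-forward i with splitAt (suc a) i
  ... | inj₁ x = ∂-gen (φ₀ x)
  ... | inj₂ w = ∂-gen-⊕-difference (φ₁ w) fz (φ₀ p₀)

  backwardP-linear : AllLinear backwardP
  backwardP-linear k with splitAt (suc a) k
  ... | inj₁ x = gen-linear (ψ₀ x)
  ... | inj₂ j = Homogeneous⁺-⊕ (gen-linear (ψ₁ (punchIn p₁ j))) s′-linear

  ∂-backwardP : ∀ k → ∂ (backwardP k) ≋ 𝟙
  ∂-backwardP k with splitAt (suc a) k
  ... | inj₁ x = ∂-gen (ψ₀ x)
  ... | inj₂ j = ∂-gen-⊕-difference (ψ₁ (punchIn p₁ j)) (ψ₀ p₀) (ψ₁ p₁)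

  backward-linear : AllLinear backward
  backward-linear fz     = gen-linear (ψ₁ p₁)
  backward-linear (fs k) = backwardP-linear k

  ∂-backward : ∀ k → ∂ (backward k) ≋ 𝟙
  ∂-backward fz     = ∂-gen (ψ₁ p₁)
  ∂-backward (fs k) = ∂-backwardP k

  eval-difference : ∀ {k n} (v : Fin k → E n) i j → eval v (gen i ⊖ gen j) ≋ v i ⊖ v j
  eval-difference v i j = ≋-trans (eval-⊕ v _ _) (⊕-cong (eval-gen v i) (≋-trans (eval-neg v _) (neg-cong (eval-gen v j))))

  backward-forward : ∀ i → eval backward (forward i) ≋ gen i
  backward-forward = ↑-elim _ on-G₀ on-G₁
    where
    on-G₀ : ∀ x → eval backward (forward (ψ₀ x)) ≋ gen (ψ₀ x)
    on-G₀ x = ≋-trans (eval-cong backward (forward-ψ₀ x)) (≋-trans (eval-gen backward (φ₀ x)) (backwardP-ι₀ x))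
    on-G₁ : ∀ w → eval backward (forward (ψ₁ w)) ≋ gen (ψ₁ w)
    on-G₁ w = begin
      eval backward (forward (ψ₁ w))
        ≈⟨ ≋-trans (eval-cong backward (forward-ψ₁ w)) (eval-⊕ backward (gen (φ₁ w)) s) ⟩
      eval backward (gen (φ₁ w)) ⊕ eval backward s
        ≈⟨ ⊕-cong (≋-trans (eval-gen backward (φ₁ w)) (backwardP-ι₁ w))
                  (≋-trans (eval-difference backward fz (φ₀ p₀)) (⊕-congˡ _ (neg-cong (backwardP-ι₀ p₀)))) ⟩
      (gen (ψ₁ w) ⊕ s′) ⊕ (gen (ψ₁ p₁) ⊖ gen (ψ₀ p₀))
        ≈⟨ [x⊕[y⊖z]]⊕[z⊖y]≋x (gen (ψ₁ w)) (gen (ψ₀ p₀)) (gen (ψ₁ p₁)) ⟩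
      gen (ψ₁ w) ∎
      where open ≋-Reasoning _

  forward-backward : ∀ k → eval forward (backward k) ≋ gen k
  forward-backward fz     = begin
    eval forward (gen (ψ₁ p₁))        ≈⟨ ≋-trans (eval-gen forward (ψ₁ p₁)) (forward-ψ₁ p₁) ⟩
    gen (φ₁ p₁) ⊕ s                   ≡⟨ ≡.cong (λ i → gen (fs i) ⊕ s) ι₁-p₁ ⟩
    gen (φ₀ p₀) ⊕ s                   ≈⟨ x⊕[y⊖x]≋y (gen (φ₀ p₀)) (gen fz) ⟩
    gen fz                            ∎
    where open ≋-Reasoning _
  forward-backward (fs k) = ↑-elim (λ k → eval forward (backwardP k) ≋ gen (fs k)) on-G₀ on-G₁ k
    where
    on-G₀ : ∀ x → eval forward (backwardP (ι₀ x)) ≋ gen (φ₀ x)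
    on-G₀ x = ≋-trans (eval-cong forward (backwardP-ι₀ x)) (≋-trans (eval-gen forward (ψ₀ x)) (forward-ψ₀ x))
    on-G₁ : ∀ j → eval forward (backwardP (suc a ↑ʳ j)) ≋ gen (fs (suc a ↑ʳ j))
    on-G₁ j = begin
      eval forward (backwardP (suc a ↑ʳ j))
        ≈⟨ ≋-trans (eval-cong forward (backwardP-↑ʳ j)) (eval-⊕ forward (gen (ψ₁ w)) s′) ⟩
      eval forward (gen (ψ₁ w)) ⊕ eval forward s′
        ≈⟨ ⊕-cong (≋-trans (eval-gen forward (ψ₁ w)) (forward-ψ₁ w))
                  (≋-trans (eval-difference forward (ψ₀ p₀) (ψ₁ p₁))
                           (⊕-cong (forward-ψ₀ p₀) (neg-cong (forward-ψ₁ p₁)))) ⟩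
      (gen (φ₁ w) ⊕ s) ⊕ (gen (φ₀ p₀) ⊖ (gen (φ₁ p₁) ⊕ s))
        ≡⟨ ≡.cong₂ (λ i i′ → (gen (fs i) ⊕ s) ⊕ (gen (φ₀ p₀) ⊖ (gen (fs i′) ⊕ s))) (ι₁-punchIn j) ι₁-p₁ ⟩
      (gen (fs (suc a ↑ʳ j)) ⊕ s) ⊕ (gen (φ₀ p₀) ⊖ (gen (φ₀ p₀) ⊕ s))
        ≈⟨ [x⊕t]⊕[y⊖[y⊕t]]≋x (gen (fs (suc a ↑ʳ j))) s (gen (φ₀ p₀)) ⟩
      gen (fs (suc a ↑ʳ j)) ∎
      where
      open ≋-Reasoning _
      w = punchIn p₁ j

  DP-image-φ₀ : ∀ {A} → Dependent G₀ A → DP (image φ₀ A)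
  DP-image-φ₀ {A} dep with dependent⇒circuit⊆ G₀ dep
  ... | C , circuit , C⊆A = ≡.subst DP (≡.sym (image-suc ι₀ A))
          (inj₂ (image ι₀ C , inj₁ (C , circuit , image-complete ι₀ C) , image-mono ι₀ C⊆A))

  DP-image-φ₁ : ∀ {B} → Dependent G₁ B → DP (image φ₁ B)
  DP-image-φ₁ {B} dep with dependent⇒circuit⊆ G₁ dep
  ... | C , circuit , C⊆B = ≡.subst DP (≡.sym (image-suc ι₁ B))
          (inj₂ (image ι₁ C , inj₂ (inj₁ (C , circuit , image-complete ι₁ C)) , image-mono ι₁ C⊆B))

  DG-image-ψ₀ : ∀ {A} → Dependent G₀ A → DG (image ψ₀ A)
  DG-image-ψ₀ {A} = inj₁ ∘ ≡.subst (Dependent G₀) (≡.sym (take-image-↑ˡ (suc b) A))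

  DG-image-ψ₁ : ∀ {B} → Dependent G₁ B → DG (image ψ₁ B)
  DG-image-ψ₁ {B} = inj₂ ∘ ≡.subst (Dependent G₁) (≡.sym (drop-image-↑ʳ (suc a) B))

  P₀-ideal : ∀ {A} → Dependent G₀ A → InIdeal DP (eval (gen ∘ φ₀) (basis A))
  P₀-ideal dep = InIdeal-eval-rename DP φ₀-injective (proj₂ (dependent⇒nonempty G₀ dep)) (DP-image-φ₀ dep)

  P₁-ideal : ∀ {B} → Dependent G₁ B → InIdeal DP (eval (gen ∘ φ₁) (basis B))
  P₁-ideal dep = InIdeal-eval-rename DP φ₁-injective (proj₂ (dependent⇒nonempty G₁ dep)) (DP-image-φ₁ dep)

  forward-ideal : ∀ S → DG S → InIdeal DP (eval forward (basis S))
  forward-ideal S dep =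
    resp (eval-cong forward (basis-≡ (image-↑ˡ-∪-image-↑ʳ (suc a) S)))
         (InIdeal-eval-∪ DP forward forward-linear (Disjoint-image-↑ˡ-↑ʳ A B) (summand dep))
    where
    A = take (suc a) S
    B = drop (suc a) S
    summand : DG S → InIdeal DP (eval forward (basis (image ψ₀ A))) ⊎ InIdeal DP (eval forward (basis (image ψ₁ B)))
    summand (inj₁ depA) = inj₁ (InIdeal-eval-image DP ψ₀-injective forward forward-linear {A}
      (resp (eval-congᵛ (≋-sym ∘ forward-ψ₀) (basis A)) (P₀-ideal depA)))
    summand (inj₂ depB) = inj₂ (InIdeal-eval-image DP ψ₁-injective forward forward-linear {B}
      (resp (eval-congᵛ (≋-sym ∘ forward-ψ₁) (basis B))
            (InIdeal-translate DP (gen ∘ φ₁) (gen-linear ∘ φ₁) (∂-gen ∘ φ₁) s-linear (basis B) (P₁-ideal depB))))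

  G₀-ideal : ∀ {C} → Dependent G₀ C → InIdeal DG (eval (gen ∘ ψ₀) (basis C))
  G₀-ideal dep = InIdeal-eval-rename DG ψ₀-injective (proj₂ (dependent⇒nonempty G₀ dep)) (DG-image-ψ₀ dep)

  G₁-ideal : ∀ {C} → Dependent G₁ C → InIdeal DG (eval (gen ∘ ψ₁) (basis C))
  G₁-ideal dep = InIdeal-eval-rename DG ψ₁-injective (proj₂ (dependent⇒nonempty G₁ dep)) (DG-image-ψ₁ dep)

  eval-backwardP-ι₁ : ∀ B → eval (backwardP ∘ ι₁) (basis B)
                            ≋ eval (gen ∘ ψ₁) (basis B) ⊕ s′ ∧ ∂ (eval (gen ∘ ψ₁) (basis B))
  eval-backwardP-ι₁ B = ≋-trans (eval-congᵛ backwardP-ι₁ (basis B))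
                                (eval-translate (gen ∘ ψ₁) (gen-linear ∘ ψ₁) (∂-gen ∘ ψ₁) s′-linear (basis B))

  glued-circuit-≡ : ∀ {C₀ C₁ T} →
    (∀ y → (y ∈ T) ⇔ ((∃ λ x → x ∈ C₀ × x ≢ p₀ × ι₀ x ≡ y) ⊎ (∃ λ x → x ∈ C₁ × x ≢ p₁ × ι₁ x ≡ y))) →
    T ≡ image ι₀ (C₀ - p₀) ∪ image ι₁ (C₁ - p₁)
  glued-circuit-≡ {C₀} {C₁} {T} T≈ = ⊆-antisym T⊆ ⊆T
    where
    T⊆ : T ⊆ image ι₀ (C₀ - p₀) ∪ image ι₁ (C₁ - p₁)
    T⊆ {y} y∈T with proj₁ (T≈ y) y∈T
    ... | inj₁ (x , x∈ , x≢ , ≡.refl) = x∈p∪q⁺ (inj₁ (∈-image⁺ ι₀ (x∈p∧x≢y⇒x∈p-y x∈ x≢)))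
    ... | inj₂ (x , x∈ , x≢ , ≡.refl) =
      x∈p∪q⁺ {p = image ι₀ (C₀ - p₀)} (inj₂ (∈-image⁺ ι₁ (x∈p∧x≢y⇒x∈p-y x∈ x≢)))
    ⊆T : image ι₀ (C₀ - p₀) ∪ image ι₁ (C₁ - p₁) ⊆ T
    ⊆T {y} y∈ with x∈p∪q⁻ (image ι₀ (C₀ - p₀)) (image ι₁ (C₁ - p₁)) y∈
    ... | inj₁ y∈₀ with ∈-image⁻ ι₀ (C₀ - p₀) y∈₀
    ...   | x , x∈ , eq = proj₂ (T≈ y) (inj₁ (x , proj₁ (∈-minus⁻ C₀ p₀ x∈) , proj₂ (∈-minus⁻ C₀ p₀ x∈) , eq))
    ⊆T {y} y∈ | inj₂ y∈₁ with ∈-image⁻ ι₁ (C₁ - p₁) y∈₁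
    ...   | x , x∈ , eq = proj₂ (T≈ y) (inj₂ (x , proj₁ (∈-minus⁻ C₁ p₁ x∈) , proj₂ (∈-minus⁻ C₁ p₁ x∈) , eq))

  Disjoint-glued : ∀ C₀ C₁ → Disjoint (image ι₀ C₀) (image ι₁ (C₁ - p₁))
  Disjoint-glued C₀ C₁ y∈₀ y∈₁ with ∈-image⁻ ι₀ C₀ y∈₀ | ∈-image⁻ ι₁ (C₁ - p₁) y∈₁
  ... | x , _ , ≡.refl | w , w∈ , eq with p₁-or-punchIn w
  ...   | inj₁ w≡p₁        = proj₂ (∈-minus⁻ C₁ p₁ w∈) w≡p₁
  ...   | inj₂ (j , ≡.refl) = ↑ˡ≢↑ʳ x j (≡.trans (≡.sym eq) (ι₁-punchIn j))

  glued-ideal : ∀ {C₀ C₁} → Circuit G₀ C₀ → p₀ ∈ C₀ → Circuit G₁ C₁ → p₁ ∈ C₁ →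
                InIdeal DG (eval backwardP (basis (image ι₀ (C₀ - p₀) ∪ image ι₁ (C₁ - p₁))))
  glued-ideal {C₀} {C₁} (dep₀ , _) p₀∈C₀ (dep₁ , _) p₁∈C₁ =
    InIdeal-≋± DG (≋±-trans (eval-basis-∪ backwardP backwardP-linear (Disjoint-glued (C₀ - p₀) C₁))
                            (≋±-∧ (eval-basis-image ι₀-injective backwardP backwardP-linear A)
                                  (eval-basis-image ι₁-injective backwardP backwardP-linear B)))
      (resp (≋-sym (∧-cong (eval-congᵛ backwardP-ι₀ (basis A)) (eval-backwardP-ι₁ B)))
            (InIdeal-glue DG (gen-linear (ψ₁ p₁)) (∂-gen (ψ₁ p₁))
              (proj₁ (InIdeal-eval-delete DG (gen ∘ ψ₀) (gen-linear ∘ ψ₀) p₀∈C₀ (G₀-ideal dep₀)))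
              (proj₂ (InIdeal-eval-delete DG (gen ∘ ψ₁) (gen-linear ∘ ψ₁) p₁∈C₁ (G₁-ideal dep₁)))))
    where
    A = C₀ - p₀
    B = C₁ - p₁

  circuit-ideal : ∀ {T} → PCircuit T → InIdeal DG (eval backwardP (basis T))
  circuit-ideal (inj₁ (C , (dep , _) , T≈)) =
    resp (eval-cong backwardP (basis-≡ (≡.sym (image-unique T≈))))
      (InIdeal-eval-image DG ι₀-injective backwardP backwardP-linear {C}
        (resp (eval-congᵛ (≋-sym ∘ backwardP-ι₀) (basis C)) (G₀-ideal dep)))
  circuit-ideal (inj₂ (inj₁ (C , (dep , _) , T≈))) =
    resp (eval-cong backwardP (basis-≡ (≡.sym (image-unique T≈))))
      (InIdeal-eval-image DG ι₁-injective backwardP backwardP-linear {C}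
        (resp (eval-congᵛ (≋-sym ∘ backwardP-ι₁) (basis C))
              (InIdeal-translate DG (gen ∘ ψ₁) (gen-linear ∘ ψ₁) (∂-gen ∘ ψ₁) s′-linear (basis C) (G₁-ideal dep))))
  circuit-ideal (inj₂ (inj₂ (C₀ , C₁ , circuit₀ , p₀∈C₀ , circuit₁ , p₁∈C₁ , T≈))) =
    resp (eval-cong backwardP (basis-≡ (≡.sym (glued-circuit-≡ T≈)))) (glued-ideal circuit₀ p₀∈C₀ circuit₁ p₁∈C₁)

  backward-ideal : ∀ S → DP S → InIdeal DG (eval backward (basis S))
  backward-ideal (x ∷ S) (inj₂ (T , circuit , T⊆S)) =
    InIdeal-eval-∷ DG backward {x} {S}
      (resp (eval-cong backwardP (basis-≡ (⊆⇒∪─≡ T⊆S)))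
            (InIdeal-eval-∪ DG backwardP backwardP-linear (Disjoint-─ S T) (inj₁ (circuit-ideal circuit))))

  isomorphism : GradedAlgIso DG DP
  isomorphism = eval-gradedAlgIso forward forward-linear ∂-forward backward backward-linear ∂-backward
                                  backward-forward forward-backward forward-ideal backward-ideal

theorem3p8 : ∀ {c ℓ} (K : Field c ℓ) (a b : ℕ)
    (G₀ : Matroid (suc a)) (G₁ : Matroid (suc b)) → Simple G₀ → Simple G₁ →
    (p₀ : Fin (suc a)) (p₁ : Fin (suc b)) →
    OS.GradedAlgIso K (DepDirectSum G₀ G₁) (DepSum DepIsthmus (DepParallel G₀ G₁ p₀ p₁))
theorem3p8 K a b G₀ G₁ _ _ p₀ p₁ = ParallelConnection.isomorphism K G₀ G₁ p₀ p₁
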